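{- Let $l$ be a prime, $k$ an algebraic extension of $\mathbb{F}_l$, and $G$ a group of finite order with $\gcd(l,|G|)=1$. Let $r:G\to\operatorname{GL}_2(k)$ be a faithful irreducible representation. Suppose that $\operatorname{ad}^0r$ is irreducible, and that there exists an odd prime $p$ such that $G$ has a non-central element of order $p$ and $k$ contains a primitive $p$-th root of unity. Then $r(G)$ is $2$-big.
   Context: $\operatorname{ad}^0 r$ denotes the representation of $G$ on $\mathfrak{sl}_2(k)$ by conjugation via $r$. Definition ($m$-big): for $k/\mathbb{F}_l$ algebraic, a subgroup $H\subset\operatorname{GL}_n(k)$ is $m$-big if: $H$ has no quotient of $l$-power order; $H^0(H,\mathfrak{sl}_n(k))=0$; $H^1(H,\mathfrak{sl}_n(k))=0$; and for every irreducible $k[H]$-submodule $W$ of $\mathfrak{gl}_n(k)$ there exist $h\in H$, $\alpha\in k$ with $\alpha$ a simple root of the characteristic polynomial of $h$, $\alpha^m\ne\beta^m$ for every other root $\beta$, and $\pi_{h,\alpha}\circ W\circ i_{h,\alpha}\ne0$, where $\pi_{h,\alpha}$, $i_{h,\alpha}$ are the $h$-equivariant projection onto and injection of the $\alpha$-eigenspace of $h$. -}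

module Defs where

open import Level using (Level; _⊔_; Lift) renaming (suc to lsuc)
open import Data.Nat as ℕ using (ℕ; zero; suc)
open import Data.Fin using (Fin)
open import Data.List using (List; []; _∷_)
open import Data.List.Relation.Unary.Any using (Any)
open import Data.Product using (Σ; ∃; ∃-syntax; _×_; _,_)
open import Data.Sum using (_⊎_)
open import Data.Unit using (⊤)
open import Relation.Nullary using (¬_)
open import Relation.Binary.PropositionalEquality using (_≡_)
open import Algebra.Bundles using (CommutativeRing; Group)
open import Algebra.Morphism.Structures using (module GroupMorphisms)

HasCard : ∀ {a ℓ} (A : Set a) (_≈_ : A → A → Set ℓ) → ℕ → Set (a ⊔ ℓ)
HasCard A _≈_ n =
  Σ (Fin n → A) λ f → (∀ i j → f i ≈ f j → i ≡ j) × (∀ x → ∃ λ i → f i ≈ x)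

GroupOrder : ∀ {c ℓ} (G : Group c ℓ) → ℕ → Set (c ⊔ ℓ)
GroupOrder G n = HasCard (Group.Carrier G) (Group._≈_ G) n

module _ {c ℓ} (G : Group c ℓ) where
  open Group G

  gpow : Carrier → ℕ → Carrier
  gpow g zero = ε
  gpow g (suc n) = g ∙ gpow g n

  HasElemOrder : Carrier → ℕ → Set ℓ
  HasElemOrder g n = gpow g n ≈ ε × (∀ m → 0 ℕ.< m → m ℕ.< n → ¬ (gpow g m ≈ ε))

  Central : Carrier → Set (c ⊔ ℓ)
  Central g = ∀ h → (g ∙ h) ≈ (h ∙ g)

  HasQuotientOfOrder : ℕ → Set (lsuc (c ⊔ ℓ))
  HasQuotientOfOrder n =
    Σ (Group c ℓ) λ Q →
    Σ (Carrier → Group.Carrier Q) λ φ →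
      GroupMorphisms.IsGroupHomomorphism (Group.rawGroup G) (Group.rawGroup Q) φ
      × (∀ q → ∃ λ g → Group._≈_ Q (φ g) q)
      × GroupOrder Q n

  NoLPowerQuotient : ℕ → Set (lsuc (c ⊔ ℓ))
  NoLPowerQuotient l = ∀ a → ¬ HasQuotientOfOrder (l ℕ.^ suc a)

module FieldDefs {kc kℓ} (K : CommutativeRing kc kℓ) where
  open CommutativeRing K

  IsField : Set (kc ⊔ kℓ)
  IsField = ¬ (1# ≈ 0#) × (∀ x → ¬ (x ≈ 0#) → ∃ λ y → (x * y) ≈ 1#)

  nat : ℕ → Carrier
  nat zero = 0#
  nat (suc n) = 1# + nat n

  pow : Carrier → ℕ → Carrier
  pow x zero = 1#
  pow x (suc n) = x * pow x n

  -- polynomial with coefficients in the prime field (list c₀,c₁,…) evaluated at x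
  evalP : List ℕ → Carrier → Carrier
  evalP [] x = 0#
  evalP (c ∷ cs) x = nat c + x * evalP cs x

  AlgebraicExtOfFl : ℕ → Set (kc ⊔ kℓ)
  AlgebraicExtOfFl l =
    nat l ≈ 0#
    × (∀ x → ∃ λ (cs : List ℕ) → Any (λ c → ¬ (nat c ≈ 0#)) cs × evalP cs x ≈ 0#)

  PrimitiveRootOfUnity : ℕ → Carrier → Set kℓ
  PrimitiveRootOfUnity p ζ = pow ζ p ≈ 1# × (∀ m → 0 ℕ.< m → m ℕ.< p → ¬ (pow ζ m ≈ 1#))

  -- vectors in K² and 2x2 matrices  ( a b ; c d )
  record V2 : Set kc where
    constructor vec
    field x y : Carrier

  record M2 : Set kc where
    constructor mat
    field a b c d : Carrier

  _≈v_ : V2 → V2 → Set kℓ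
  vec x y ≈v vec x' y' = (x ≈ x') × (y ≈ y')

  _≈m_ : M2 → M2 → Set kℓ
  mat a b c d ≈m mat a' b' c' d' = (a ≈ a') × (b ≈ b') × (c ≈ c') × (d ≈ d')

  0v : V2
  0v = vec 0# 0#

  _+v_ : V2 → V2 → V2
  vec x y +v vec x' y' = vec (x + x') (y + y')

  _·v_ : Carrier → V2 → V2
  s ·v vec x y = vec (s * x) (s * y)

  0m : M2
  0m = mat 0# 0# 0# 0#

  Im : M2
  Im = mat 1# 0# 0# 1#

  _+m_ : M2 → M2 → M2
  mat a b c d +m mat a' b' c' d' = mat (a + a') (b + b') (c + c') (d + d')

  _-m_ : M2 → M2 → M2
  mat a b c d -m mat a' b' c' d' = mat (a - a') (b - b') (c - c') (d - d')

  _·m_ : Carrier → M2 → M2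
  s ·m mat a b c d = mat (s * a) (s * b) (s * c) (s * d)

  _*m_ : M2 → M2 → M2
  mat a b c d *m mat a' b' c' d' =
    mat (a * a' + b * c') (a * b' + b * d') (c * a' + d * c') (c * b' + d * d')

  _$v_ : M2 → V2 → V2
  mat a b c d $v vec x y = vec (a * x + b * y) (c * x + d * y)

  tr : M2 → Carrier
  tr (mat a b c d) = a + d

  det : M2 → Carrier
  det (mat a b c d) = a * d - b * c

  charPoly : M2 → Carrier → Carrier
  charPoly h t = t * t - tr h * t + det h

  IsRoot : M2 → Carrier → Set kℓ
  IsRoot h α = charPoly h α ≈ 0#

  -- α is a simple root of charPoly h: charPoly h = (t - α)(t - (tr h - α))
  -- and α is not a root of the cofactor t - (tr h - α).
  IsSimpleRoot : M2 → Carrier → Set kℓ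
  IsSimpleRoot h α = IsRoot h α × ¬ ((α - (tr h - α)) ≈ 0#)

  record Space : Set (lsuc (kc ⊔ kℓ)) where
    field
      V    : Set kc
      _≈V_ : V → V → Set kℓ
      0V   : V
      _+V_ : V → V → V
      _·V_ : Carrier → V → V

  LevelP : Level
  LevelP = kc ⊔ kℓ

  module _ (S : Space) where
    open Space S

    IsSubspace : (V → Set LevelP) → Set (kc ⊔ kℓ)
    IsSubspace W =
      (∀ {u v} → u ≈V v → W u → W v)
      × W 0V
      × (∀ {u v} → W u → W v → W (u +V v))
      × (∀ s {v} → W v → W (s ·V v))

    module _ {c} {G : Set c} (act : G → V → V) where

      IsInvariant : (V → Set LevelP) → Set (c ⊔ kc ⊔ kℓ)
      IsInvariant W = ∀ g {v} → W v → W (act g v)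

      IsIrreducibleSub : (V → Set LevelP) → Set (lsuc (kc ⊔ kℓ) ⊔ c)
      IsIrreducibleSub W =
        IsSubspace W × IsInvariant W
        × (∃ λ v → W v × ¬ (v ≈V 0V))
        × (∀ (P : V → Set LevelP) → IsSubspace P → IsInvariant P
             → (∀ {v} → P v → W v)
             → (∀ {v} → P v → v ≈V 0V) ⊎ (∀ {v} → W v → P v))

  K2 : Space
  K2 = record { V = V2 ; _≈V_ = _≈v_ ; 0V = 0v ; _+V_ = _+v_ ; _·V_ = _·v_ }

  gl2 : Space
  gl2 = record { V = M2 ; _≈V_ = _≈m_ ; 0V = 0m ; _+V_ = _+m_ ; _·V_ = _·m_ }

  sl2 : M2 → Set LevelP
  sl2 m = Lift kc (tr m ≈ 0#)

  everything : V2 → Set LevelP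
  everything _ = Lift LevelP ⊤

  module _ {c ℓ} (G : Group c ℓ) where
    private module G = Group G

    record Rep2 : Set (c ⊔ ℓ ⊔ kc ⊔ kℓ) where
      field
        ρ      : G.Carrier → M2
        ρ-cong : ∀ {g h} → g G.≈ h → ρ g ≈m ρ h
        ρ-mul  : ∀ g h → ρ (g G.∙ h) ≈m (ρ g *m ρ h)
        ρ-one  : ρ G.ε ≈m Im
        ρ-inv  : ∀ g → ¬ (det (ρ g) ≈ 0#)

    module _ (r : Rep2) where
      open Rep2 r

      Faithful : Set (c ⊔ ℓ ⊔ kℓ)
      Faithful = ∀ g h → ρ g ≈m ρ h → g G.≈ h

      std : G.Carrier → V2 → V2
      std g v = ρ g $v v

      -- action on gl₂ by conjugation (the k[H]-module structure of gl₂, and ad⁰ on sl₂)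
      ad : G.Carrier → M2 → M2
      ad g m = ρ g *m (m *m ρ (G._⁻¹ g))

      IrreducibleRep : Set (lsuc (kc ⊔ kℓ) ⊔ c)
      IrreducibleRep = IsIrreducibleSub K2 std everything

      Ad0Irreducible : Set (lsuc (kc ⊔ kℓ) ⊔ c)
      Ad0Irreducible = IsIrreducibleSub gl2 ad sl2

      IsEigenProj : M2 → Carrier → M2 → Set (kc ⊔ kℓ)
      IsEigenProj h α π =
        (π *m h) ≈m (h *m π)
        × (∀ v → (h $v v) ≈v (α ·v v) → (π $v v) ≈v v)
        × (∀ v → (h $v (π $v v)) ≈v (α ·v (π $v v)))

      ProjNonzero : M2 → Carrier → (M2 → Set LevelP) → Set (kc ⊔ kℓ)
      ProjNonzero h α W =
        ∃ λ π → IsEigenProj h α π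
          × ∃ λ w → W w × ∃ λ v → (h $v v) ≈v (α ·v v)
          × ¬ ((π $v (w $v v)) ≈v 0v)

      -- the image r(G) ⊂ GL₂(K) is m-big (for n = 2); since r is faithful,
      -- r(G) is identified with G acting through r.
      IsBig : ℕ → ℕ → Set (lsuc (c ⊔ ℓ ⊔ kc ⊔ kℓ))
      IsBig l m =
        NoLPowerQuotient G l
        × (∀ x → sl2 x → (∀ g → ad g x ≈m x) → x ≈m 0m)
        × (∀ (f : G.Carrier → M2)
             → (∀ {g h} → g G.≈ h → f g ≈m f h)
             → (∀ g → sl2 (f g))
             → (∀ g h → f (g G.∙ h) ≈m (f g +m ad g (f h)))
             → ∃ λ x → sl2 x × (∀ g → f g ≈m (ad g x -m x)))
        × (∀ (W : M2 → Set LevelP) → IsIrreducibleSub gl2 ad W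
             → ∃ λ g → ∃ λ α →
                 IsSimpleRoot (ρ g) α
                 × (∀ β → IsRoot (ρ g) β → ¬ (β ≈ α) → ¬ (pow α m ≈ pow β m))
                 × ProjNonzero (ρ g) α W)

-- Irreducibility of r makes equality in k decidable: a proposition Q enlarges
-- the zero subspace of k² to an invariant subspace which is everything exactly
-- when Q holds. As |G| is invertible in k, averaging over G kills H¹(G, sl₂)
-- and counting fibres rules out quotients of l-power order, while
-- irreducibility of ad⁰ r kills H⁰ and forces char k ≠ 2. For the last
-- condition take h = r(g) with g non-central of odd prime order p. Since k has
-- a primitive p-th root of unity ζ, p is invertible in k and the twisted sums
-- ∑ᵢ ζ^{ij} hⁱ v decompose k² into eigenspaces of h; as h is not scalar it has
-- two distinct eigenvalues α, β, both p-th roots of unity, so α² ≠ β² because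
-- p is odd. The projection π = (h − β)/(α − β) onto the α-eigenspace detects
-- every irreducible W ⊆ gl₂: either W ∩ sl₂ = 0, and then W consists of
-- scalars, or W = sl₂, which contains 2π − 1.
module Submission where

open import Defs
open import Data.Nat using (ℕ)
open import Data.Nat.Primality using (Prime)
open import Data.Nat.GCD using (gcd)
open import Data.Product using (∃; _×_; _,_; proj₁; proj₂)
open import Relation.Nullary using (¬_)
open import Relation.Binary.PropositionalEquality using (_≡_)
open import Algebra.Bundles using (CommutativeRing; CommutativeMonoid; Group)
open import Relation.Binary.Definitions using (Decidable)

module PrimeArithmetic where
  open import Data.Nat
  open import Data.Nat.Properties
  open import Data.Nat.Divisibility
  open import Data.Nat.DivMod using (m/n*n≡m)
  open import Data.Nat.Primality
  open import Data.Nat.Combinatorics using (_C_; k![n∸k]!∣n!)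
  open import Data.Nat.Combinatorics.Specification using (nCk≡n!/k![n-k]!)
  open import Data.Sum using (_⊎_; inj₁; inj₂)
  open import Data.Product using (∃; _,_)
  open import Data.Empty using (⊥-elim)
  open import Relation.Nullary using (¬_)
  open import Relation.Binary.PropositionalEquality

  prime>1 : ∀ {p} → Prime p → 1 < p
  prime>1 {p} p-prime = nonTrivial⇒n>1 p {{prime⇒nonTrivial p-prime}}

  prime∤! : ∀ {p} → Prime p → ∀ m → m < p → ¬ (p ∣ m !)
  prime∤! p-prime zero m<p p∣1 with ∣1⇒≡1 p∣1
  ... | refl = <-irrefl refl (prime>1 p-prime)
  prime∤! p-prime (suc m) m<p p∣m! with euclidsLemma (suc m) (m !) p-prime p∣m!
  ... | inj₁ p∣1+m = <-irrefl refl (<-≤-trans m<p (∣⇒≤ p∣1+m))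
  ... | inj₂ p∣m! = prime∤! p-prime m (<-trans (n<1+n m) m<p) p∣m!

  prime∣C : ∀ {p} → Prime p → ∀ k → 0 < k → k < p → p ∣ p C k
  prime∣C {p} p-prime k 0<k k<p
    with euclidsLemma (p C k) (k ! * (p ∸ k) !) p-prime p∣C*!*!
    where
    instance
      k!*[p∸k]!≢0 : NonZero (k ! * (p ∸ k) !)
      k!*[p∸k]!≢0 = k !* (p ∸ k) !≢0
    C*!*!≡! : (p C k) * (k ! * (p ∸ k) !) ≡ p !
    C*!*!≡! = trans (cong (_* (k ! * (p ∸ k) !)) (nCk≡n!/k![n-k]! (<⇒≤ k<p)))
                    (m/n*n≡m (k![n∸k]!∣n! (<⇒≤ k<p)))
    p∣C*!*! : p ∣ (p C k) * (k ! * (p ∸ k) !)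
    p∣C*!*! = subst (p ∣_) (sym C*!*!≡!) (n∣n! p (prime>1 p-prime))
      where n∣n! : ∀ n → 1 < n → n ∣ n !
            n∣n! (suc n) _ = m∣m*n (n !)
  ... | inj₁ p∣C = p∣C
  ... | inj₂ p∣!*! with euclidsLemma (k !) ((p ∸ k) !) p-prime p∣!*!
  ... | inj₁ p∣k! = ⊥-elim (prime∤! p-prime k k<p p∣k!)
  ... | inj₂ p∣[p∸k]! = ⊥-elim (prime∤! p-prime (p ∸ k) (∸-monoʳ-< 0<k (<⇒≤ k<p)) p∣[p∸k]!)

  even⊎odd : ∀ n → ∃ λ m → n ≡ m + m ⊎ n ≡ suc (m + m)
  even⊎odd zero = 0 , inj₁ refl
  even⊎odd (suc n) with even⊎odd n
  ... | m , inj₁ n≡m+m = m , inj₂ (cong suc n≡m+m)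
  ... | m , inj₂ n≡1+m+m = suc m , inj₁ (cong suc (trans n≡1+m+m (sym (+-suc m m))))

  odd-prime : ∀ {p} → Prime p → p ≢ 2 → ∃ λ m → p ≡ suc (m + m)
  odd-prime {p} p-prime p≢2 with even⊎odd p
  ... | m , inj₂ p≡1+m+m = m , p≡1+m+m
  ... | m , inj₁ p≡m+m with prime⇒irreducible p-prime (divides m (trans p≡m+m (m+m≡m*2 m)))
    where m+m≡m*2 : ∀ m → m + m ≡ m * 2
          m+m≡m*2 m = trans (cong (m +_) (sym (+-identityʳ m))) (*-comm 2 m)
  ... | inj₁ ()
  ... | inj₂ 2≡p = ⊥-elim (p≢2 (sym 2≡p))

module FiniteSums {c ℓ} (M : CommutativeMonoid c ℓ) where
  open import Data.Nat using (ℕ; zero; suc)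
  open import Data.Fin using (Fin; toℕ; inject₁; fromℕ)
  open import Data.Fin.Properties using (toℕ-inject₁; toℕ-fromℕ; punchInᵢ≢i)
  open import Relation.Nullary using (¬_)
  open import Relation.Binary.PropositionalEquality as ≡ using (_≡_)

  open CommutativeMonoid M renaming (_∙_ to _+_; ε to 0#; ∙-cong to +-cong; ∙-congˡ to +-congˡ; ∙-congʳ to +-congʳ)
  open import Algebra.Properties.CommutativeMonoid.Sum M public
  open import Relation.Binary.Reasoning.Setoid setoid

  sum-zero : ∀ {n} (t : Fin n → Carrier) → (∀ i → t i ≈ 0#) → sum t ≈ 0#
  sum-zero {zero} t t≈0 = refl
  sum-zero {suc n} t t≈0 = trans (+-cong (t≈0 Fin.zero) (sum-zero (λ i → t (Fin.suc i)) (λ i → t≈0 (Fin.suc i)))) (identityʳ 0#)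

  sum-single : ∀ {n} (t : Fin n → Carrier) (i : Fin n) → (∀ j → ¬ (j ≡ i) → t j ≈ 0#) → sum t ≈ t i
  sum-single {suc n} t i others≈0 = begin
    sum t                     ≈⟨ sum-remove t ⟩
    t i + sum (removeAt t i)  ≈⟨ +-congˡ (sum-zero _ (λ j → others≈0 _ (punchInᵢ≢i i j))) ⟩
    t i + 0#                  ≈⟨ identityʳ (t i) ⟩
    t i                       ∎
    where open import Data.Vec.Functional using (removeAt)

  sum-shift : ∀ n (f : ℕ → Carrier) → sum {n} (λ i → f (suc (toℕ i))) + f 0 ≈ sum {n} (λ i → f (toℕ i)) + f n
  sum-shift n f = begin
    sum {n} (λ i → f (suc (toℕ i))) + f 0  ≈⟨ comm _ _ ⟩
    sum {suc n} (λ i → f (toℕ i))          ≈⟨ sum-init-last {n} (λ i → f (toℕ i)) ⟩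
    sum {n} (λ i → f (toℕ (inject₁ i))) + f (toℕ (fromℕ n))
      ≡⟨ ≡.cong₂ (λ s k → s + f k) (sum-cong-≗ {n} (λ i → ≡.cong f (toℕ-inject₁ i))) (toℕ-fromℕ n) ⟩
    sum {n} (λ i → f (toℕ i)) + f n             ∎

module SumHomomorphism {c ℓ c′ ℓ′} (M : CommutativeMonoid c ℓ) (N : CommutativeMonoid c′ ℓ′) where
  open import Data.Nat using (zero; suc)
  open import Data.Fin using (Fin)
  private
    module M = CommutativeMonoid M
    module N = CommutativeMonoid N
  open FiniteSums M using () renaming (sum to sumᴹ)
  open FiniteSums N using () renaming (sum to sumᴺ)

  sum-homo : ∀ (f : M.Carrier → N.Carrier) → f M.ε N.≈ N.ε → (∀ x y → f (x M.∙ y) N.≈ (f x N.∙ f y)) →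
             ∀ {n} (t : Fin n → M.Carrier) → f (sumᴹ t) N.≈ sumᴺ (λ i → f (t i))
  sum-homo f f-ε f-∙ {zero} t = f-ε
  sum-homo f f-ε f-∙ {suc n} t =
    N.trans (f-∙ (t Fin.zero) _) (N.∙-congˡ (sum-homo f f-ε f-∙ (λ i → t (Fin.suc i))))

module RingArithmetic {kc kℓ} (K : CommutativeRing kc kℓ) where
  open import Data.Nat as ℕ using (ℕ; zero; suc; _<_)
  import Data.Nat.Properties as ℕ
  open import Data.Nat.Primality using (Prime)
  open import Data.Nat.Divisibility using (divides)
  open import Data.Nat.Combinatorics using (_C_; nCn≡1; nCk≡nC[n∸k])
  open import Data.Nat.GCD using (gcd; gcd-GCD; GCD; module Bézout)
  open import Data.Fin as Fin using (Fin)
  import Data.Fin.Properties as Fin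
  open import Data.Product using (∃; _,_)
  open import Relation.Binary.PropositionalEquality as ≡ using (_≡_)
  open import Defs
  open PrimeArithmetic using (prime>1; prime∣C)

  open CommutativeRing K
  open FieldDefs K using (nat; pow)
  open import Algebra.Properties.Ring ring using (-‿distribʳ-*; -‿involutive)
  open import Algebra.Properties.Group +-group using (inverseʳ-unique)
  open import Algebra.Properties.Semiring.Mult semiring using (×-homo-+; ×1-homo-*) renaming (_×_ to _×ᵤ_)
  open import Algebra.Properties.Semiring.Exp semiring using (_^_; ^-congˡ; ^-assocʳ)
  open import Algebra.Properties.CommutativeSemiring.Binomial commutativeSemiring using (theorem; binomialTerm)
  open FiniteSums +-commutativeMonoid using (sum; sum-init-last; sum-zero)
  open import Relation.Binary.Reasoning.Setoid setoid

  nat≈×ᵤ1# : ∀ n → nat n ≈ n ×ᵤ 1#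
  nat≈×ᵤ1# zero = refl
  nat≈×ᵤ1# (suc n) = +-congˡ (nat≈×ᵤ1# n)

  nat-homo-+ : ∀ m n → nat (m ℕ.+ n) ≈ nat m + nat n
  nat-homo-+ m n = begin
    nat (m ℕ.+ n)      ≈⟨ nat≈×ᵤ1# (m ℕ.+ n) ⟩
    (m ℕ.+ n) ×ᵤ 1#    ≈⟨ ×-homo-+ 1# m n ⟩
    m ×ᵤ 1# + n ×ᵤ 1#  ≈⟨ +-cong (nat≈×ᵤ1# m) (nat≈×ᵤ1# n) ⟨
    nat m + nat n      ∎

  nat-homo-* : ∀ m n → nat (m ℕ.* n) ≈ nat m * nat n
  nat-homo-* m n = begin
    nat (m ℕ.* n)          ≈⟨ nat≈×ᵤ1# (m ℕ.* n) ⟩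
    (m ℕ.* n) ×ᵤ 1#        ≈⟨ ×1-homo-* m n ⟩
    (m ×ᵤ 1#) * (n ×ᵤ 1#)  ≈⟨ *-cong (nat≈×ᵤ1# m) (nat≈×ᵤ1# n) ⟨
    nat m * nat n          ∎

  pow≈^ : ∀ x n → pow x n ≈ x ^ n
  pow≈^ x zero = refl
  pow≈^ x (suc n) = *-congˡ (pow≈^ x n)

  pow-congˡ : ∀ n {x y} → x ≈ y → pow x n ≈ pow y n
  pow-congˡ zero x≈y = refl
  pow-congˡ (suc n) x≈y = *-cong x≈y (pow-congˡ n x≈y)

  pow-homo-* : ∀ x m n → pow x (m ℕ.+ n) ≈ pow x m * pow x n
  pow-homo-* x zero n = sym (*-identityˡ _)
  pow-homo-* x (suc m) n = trans (*-congˡ (pow-homo-* x m n)) (sym (*-assoc _ _ _))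

  pow-assocʳ : ∀ x m n → pow (pow x m) n ≈ pow x (m ℕ.* n)
  pow-assocʳ x m n = begin
    pow (pow x m) n  ≈⟨ pow≈^ (pow x m) n ⟩
    pow x m ^ n      ≈⟨ ^-congˡ n (pow≈^ x m) ⟩
    (x ^ m) ^ n      ≈⟨ ^-assocʳ x m n ⟩
    x ^ (m ℕ.* n)    ≈⟨ pow≈^ x (m ℕ.* n) ⟨
    pow x (m ℕ.* n)  ∎

  pow-comm : ∀ x m n → pow (pow x m) n ≈ pow (pow x n) m
  pow-comm x m n = begin
    pow (pow x m) n  ≈⟨ pow-assocʳ x m n ⟩
    pow x (m ℕ.* n)  ≡⟨ ≡.cong (pow x) (ℕ.*-comm m n) ⟩
    pow x (n ℕ.* m)  ≈⟨ pow-assocʳ x n m ⟨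
    pow (pow x n) m  ∎

  pow-1# : ∀ n → pow 1# n ≈ 1#
  pow-1# zero = refl
  pow-1# (suc n) = trans (*-identityˡ _) (pow-1# n)

  nat-multiple≈0 : ∀ {l} → nat l ≈ 0# → ∀ x → nat (x ℕ.* l) ≈ 0#
  nat-multiple≈0 {l} natl≈0 x = begin
    nat (x ℕ.* l)  ≈⟨ nat-homo-* x l ⟩
    nat x * nat l  ≈⟨ *-congˡ natl≈0 ⟩
    nat x * 0#     ≈⟨ zeroʳ _ ⟩
    0#             ∎

  ×ᵤ≈nat* : ∀ n x → n ×ᵤ x ≈ nat n * x
  ×ᵤ≈nat* zero x = sym (zeroˡ x)
  ×ᵤ≈nat* (suc n) x = begin
    x + n ×ᵤ x          ≈⟨ +-cong (sym (*-identityˡ x)) (×ᵤ≈nat* n x) ⟩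
    1# * x + nat n * x  ≈⟨ distribʳ x 1# (nat n) ⟨
    (1# + nat n) * x    ∎

  coprime⇒nat-invertible : ∀ l m → nat l ≈ 0# → gcd l m ≡ 1 → ∃ λ y → nat m * y ≈ 1#
  coprime⇒nat-invertible l m natl≈0 gcd≡1
    with Bézout.identity (≡.subst (GCD l m) gcd≡1 (gcd-GCD l m))
  ... | Bézout.Identity.+- x y 1+ym≡xl = - nat y , (begin
    nat m * - nat y    ≈⟨ -‿distribʳ-* (nat m) (nat y) ⟨
    - (nat m * nat y)  ≈⟨ -‿cong (trans (*-comm _ _) ym≈-1) ⟩
    - - 1#             ≈⟨ -‿involutive 1# ⟩
    1#                 ∎)
    where
    ym≈-1 : nat y * nat m ≈ - 1#
    ym≈-1 = inverseʳ-unique 1# (nat y * nat m) (begin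
      1# + nat y * nat m   ≈⟨ +-congˡ (nat-homo-* y m) ⟨
      nat (1 ℕ.+ y ℕ.* m)  ≡⟨ ≡.cong nat 1+ym≡xl ⟩
      nat (x ℕ.* l)        ≈⟨ nat-multiple≈0 natl≈0 x ⟩
      0#                   ∎)
  ... | Bézout.Identity.-+ x y 1+xl≡ym = nat y , (begin
    nat m * nat y       ≈⟨ *-comm _ _ ⟩
    nat y * nat m       ≈⟨ nat-homo-* y m ⟨
    nat (y ℕ.* m)       ≡⟨ ≡.cong nat 1+xl≡ym ⟨
    1# + nat (x ℕ.* l)  ≈⟨ +-congˡ (nat-multiple≈0 natl≈0 x) ⟩
    1# + 0#             ≈⟨ +-identityʳ 1# ⟩
    1#                  ∎)

  binomial-coefficient≈0 : ∀ {p} → Prime p → nat p ≈ 0# → ∀ {k} → 0 < k → k < p → ∀ z → (p C k) ×ᵤ z ≈ 0#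
  binomial-coefficient≈0 {p} p-prime natp≈0 {k} 0<k k<p z with prime∣C p-prime k 0<k k<p
  ... | divides q C≡qp = begin
    (p C k) ×ᵤ z       ≈⟨ ×ᵤ≈nat* (p C k) z ⟩
    nat (p C k) * z    ≡⟨ ≡.cong (λ c → nat c * z) C≡qp ⟩
    nat (q ℕ.* p) * z  ≈⟨ *-congʳ (nat-multiple≈0 natp≈0 q) ⟩
    0# * z             ≈⟨ zeroˡ z ⟩
    0#                 ∎

  frobenius : ∀ {p} → Prime p → nat p ≈ 0# → ∀ x y → pow (x + y) p ≈ pow x p + pow y p
  frobenius {zero} p-prime _ with prime>1 p-prime
  ... | ()
  frobenius {suc m} p-prime natp≈0 x y = begin
    pow (x + y) p                           ≈⟨ pow≈^ (x + y) p ⟩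
    (x + y) ^ p                             ≈⟨ theorem p x y ⟩
    t Fin.zero + sum (λ i → t (Fin.suc i))  ≈⟨ +-congˡ (sum-init-last (λ i → t (Fin.suc i))) ⟩
    t Fin.zero + (sum (λ i → t (Fin.suc (Fin.inject₁ i))) + t (Fin.fromℕ p))
                                                         ≈⟨ +-congˡ (+-congʳ (sum-zero _ middle≈0)) ⟩
    t Fin.zero + (0# + t (Fin.fromℕ p))                  ≈⟨ +-cong first≈ (trans (+-identityˡ _) last≈) ⟩
    pow y p + pow x p                                    ≈⟨ +-comm _ _ ⟩
    pow x p + pow y p                                    ∎
    where
    p : ℕ
    p = suc m
    t : Fin (suc p) → Carrier
    t = binomialTerm x y p
    middle≈0 : ∀ i → t (Fin.suc (Fin.inject₁ i)) ≈ 0#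
    middle≈0 i = binomial-coefficient≈0 p-prime natp≈0 ℕ.z<s
      (ℕ.s≤s (≡.subst (ℕ._< m) (≡.sym (Fin.toℕ-inject₁ i)) (Fin.toℕ<n i))) _
    first≈ : t Fin.zero ≈ pow y p
    first≈ = begin
      (p C 0) ×ᵤ (1# * y ^ p)  ≡⟨ ≡.cong (_×ᵤ (1# * y ^ p)) (≡.trans (nCk≡nC[n∸k] {0} {p} ℕ.z≤n) (nCn≡1 p)) ⟩
      1 ×ᵤ (1# * y ^ p)        ≈⟨ +-identityʳ _ ⟩
      1# * y ^ p               ≈⟨ *-identityˡ _ ⟩
      y ^ p                    ≈⟨ pow≈^ y p ⟨
      pow y p                  ∎
    last≈ : t (Fin.fromℕ p) ≈ pow x p
    last≈ = top (Fin.toℕ (Fin.fromℕ p)) (Fin.toℕ-fromℕ p)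
      where
      top : ∀ k → k ≡ p → (p C k) ×ᵤ ((x ^ k) * (y ^ (p ℕ.∸ k))) ≈ pow x p
      top k ≡.refl rewrite nCn≡1 p | ℕ.n∸n≡0 p = trans (+-identityʳ _) (trans (*-identityʳ _) (sym (pow≈^ x p)))

module IntegerRingSolver {kc kℓ} (K : CommutativeRing kc kℓ) where
  open import Data.Nat as ℕ using (zero; suc)
  open import Data.Integer as ℤ using (ℤ; +_; -[1+_])
  import Data.Integer.Properties as ℤ
  open import Data.Maybe using (Maybe; just; nothing)
  open import Relation.Nullary using (yes; no)
  open import Relation.Binary.PropositionalEquality as ≡ using (_≡_)
  open import Defs

  open CommutativeRing K
  open FieldDefs K using (nat)
  open RingArithmetic K using (nat≈×ᵤ1#; nat-homo-+)
  open import Algebra.Properties.Ring ring using (-‿distribʳ-*; -‿involutive; -0#≈0#)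
  open import Algebra.Properties.AbelianGroup +-abelianGroup using (⁻¹-∙-comm)
  open import Algebra.Properties.CommutativeSemigroup +-commutativeSemigroup using (interchange; x∙yz≈y∙xz)
  open import Algebra.Properties.Semiring.Mult.TCOptimised semiring using (×ᵤ≈×) renaming (_×_ to _×′_)
  open import Algebra.Solver.Ring.AlmostCommutativeRing using (fromCommutativeRing; _-Raw-AlmostCommutative⟶_)
  open import Relation.Binary.Reasoning.Setoid setoid

  -- ι uses the type-checking-optimised multiple, so that ι (+ 0) and ι (+ 1)
  -- are definitionally 0# and 1# as the solver needs; the homomorphism laws
  -- are proved for the unoptimised ιᵤ.
  ι : ℤ → Carrier
  ι (+ n) = n ×′ 1#
  ι -[1+ n ] = - (suc n ×′ 1#)

  ιᵤ : ℤ → Carrier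
  ιᵤ (+ n) = nat n
  ιᵤ -[1+ n ] = - nat (suc n)

  ιᵤ-⊖ : ∀ m n → ιᵤ (m ℤ.⊖ n) ≈ nat m - nat n
  ιᵤ-⊖ m zero = sym (trans (+-congˡ -0#≈0#) (+-identityʳ (nat m)))
  ιᵤ-⊖ zero (suc n) = sym (+-identityˡ _)
  ιᵤ-⊖ (suc m) (suc n) = begin
    ιᵤ (suc m ℤ.⊖ suc n)           ≡⟨ ≡.cong ιᵤ (ℤ.[1+m]⊖[1+n]≡m⊖n m n) ⟩
    ιᵤ (m ℤ.⊖ n)                   ≈⟨ ιᵤ-⊖ m n ⟩
    nat m - nat n                  ≈⟨ +-identityˡ _ ⟨
    0# + (nat m - nat n)           ≈⟨ +-congʳ (-‿inverseʳ 1#) ⟨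
    (1# - 1#) + (nat m - nat n)    ≈⟨ interchange 1# (- 1#) (nat m) (- nat n) ⟩
    (1# + nat m) + (- 1# - nat n)  ≈⟨ +-congˡ (⁻¹-∙-comm 1# (nat n)) ⟩
    (1# + nat m) - (1# + nat n)    ∎

  ιᵤ-homo-neg : ∀ i → ιᵤ (ℤ.- i) ≈ - ιᵤ i
  ιᵤ-homo-neg (+ zero) = sym -0#≈0#
  ιᵤ-homo-neg (+ suc n) = refl
  ιᵤ-homo-neg -[1+ n ] = sym (-‿involutive _)

  ιᵤ-homo-+ : ∀ i j → ιᵤ (i ℤ.+ j) ≈ ιᵤ i + ιᵤ j
  ιᵤ-homo-+ (+ m) (+ n) = nat-homo-+ m n
  ιᵤ-homo-+ (+ m) -[1+ n ] = ιᵤ-⊖ m (suc n)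
  ιᵤ-homo-+ -[1+ m ] (+ n) = trans (ιᵤ-⊖ n (suc m)) (+-comm _ _)
  ιᵤ-homo-+ -[1+ m ] -[1+ n ] = begin
    - nat (suc (suc (m ℕ.+ n)))     ≈⟨ -‿cong (+-congˡ (nat-homo-+ (suc m) n)) ⟩
    - (1# + (nat (suc m) + nat n))  ≈⟨ -‿cong (x∙yz≈y∙xz 1# (nat (suc m)) (nat n)) ⟩
    - (nat (suc m) + nat (suc n))   ≈⟨ ⁻¹-∙-comm (nat (suc m)) (nat (suc n)) ⟨
    - nat (suc m) + - nat (suc n)   ∎

  ιᵤ-homo-*ℕ : ∀ i n → ιᵤ (i ℤ.* + n) ≈ ιᵤ i * nat n
  ιᵤ-homo-*ℕ i zero = begin
    ιᵤ (i ℤ.* + 0)  ≡⟨ ≡.cong ιᵤ (ℤ.*-zeroʳ i) ⟩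
    0#              ≈⟨ zeroʳ (ιᵤ i) ⟨
    ιᵤ i * 0#       ∎
  ιᵤ-homo-*ℕ i (suc n) = begin
    ιᵤ (i ℤ.* + suc n)        ≡⟨ ≡.cong ιᵤ (ℤ.*-suc i (+ n)) ⟩
    ιᵤ (i ℤ.+ i ℤ.* + n)      ≈⟨ ιᵤ-homo-+ i (i ℤ.* + n) ⟩
    ιᵤ i + ιᵤ (i ℤ.* + n)     ≈⟨ +-cong (sym (*-identityʳ _)) (ιᵤ-homo-*ℕ i n) ⟩
    ιᵤ i * 1# + ιᵤ i * nat n  ≈⟨ distribˡ _ _ _ ⟨
    ιᵤ i * (1# + nat n)       ∎

  ιᵤ-homo-* : ∀ i j → ιᵤ (i ℤ.* j) ≈ ιᵤ i * ιᵤ j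
  ιᵤ-homo-* i (+ n) = ιᵤ-homo-*ℕ i n
  ιᵤ-homo-* i -[1+ n ] = begin
    ιᵤ (i ℤ.* -[1+ n ])       ≡⟨ ≡.cong ιᵤ (ℤ.neg-distribʳ-* i (+ suc n)) ⟨
    ιᵤ (ℤ.- (i ℤ.* + suc n))  ≈⟨ ιᵤ-homo-neg (i ℤ.* + suc n) ⟩
    - ιᵤ (i ℤ.* + suc n)      ≈⟨ -‿cong (ιᵤ-homo-*ℕ i (suc n)) ⟩
    - (ιᵤ i * nat (suc n))    ≈⟨ -‿distribʳ-* _ _ ⟩
    ιᵤ i * - nat (suc n)      ∎

  ι≈ιᵤ : ∀ i → ι i ≈ ιᵤ i
  ι≈ιᵤ (+ n) = sym (trans (nat≈×ᵤ1# n) (×ᵤ≈× n 1#))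
  ι≈ιᵤ -[1+ n ] = -‿cong (sym (trans (nat≈×ᵤ1# (suc n)) (×ᵤ≈× (suc n) 1#)))

  ι-homomorphism : ℤ.+-*-rawRing -Raw-AlmostCommutative⟶ fromCommutativeRing K
  ι-homomorphism = record
    { ⟦_⟧ = ι
    ; +-homo = λ i j → transport (ιᵤ-homo-+ i j) (ι≈ιᵤ (i ℤ.+ j)) (+-cong (ι≈ιᵤ i) (ι≈ιᵤ j))
    ; *-homo = λ i j → transport (ιᵤ-homo-* i j) (ι≈ιᵤ (i ℤ.* j)) (*-cong (ι≈ιᵤ i) (ι≈ιᵤ j))
    ; -‿homo = λ i → transport (ιᵤ-homo-neg i) (ι≈ιᵤ (ℤ.- i)) (-‿cong (ι≈ιᵤ i))
    ; 0-homo = refl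
    ; 1-homo = refl
    }
    where
    transport : ∀ {x y x′ y′} → x′ ≈ y′ → x ≈ x′ → y ≈ y′ → x ≈ y
    transport x′≈y′ x≈x′ y≈y′ = trans x≈x′ (trans x′≈y′ (sym y≈y′))

  ι-≟ : ∀ i j → Maybe (ι i ≈ ι j)
  ι-≟ i j with i ℤ.≟ j
  ... | yes ≡.refl = just refl
  ... | no _ = nothing

  open import Algebra.Solver.Ring ℤ.+-*-rawRing (fromCommutativeRing K) ι-homomorphism ι-≟ public
    using (solve; prove; Polynomial; ⟦_⟧; ⟦_⟧↓; _:=_; _:+_; _:*_; :-_; _:-_; con; var)

module Matrices {kc kℓ} (K : CommutativeRing kc kℓ) where
  open import Data.Nat as ℕ using (ℕ; zero; suc)
  open import Data.Fin using (Fin)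
  open import Data.Integer using (+_)
  open import Data.Vec using (Vec; []; _∷_; _++_)
  open import Data.Product using (_×_; _,_)
  open import Relation.Binary.Bundles using (Setoid)
  open import Algebra.Bundles using (CommutativeMonoid)
  open import Defs

  open CommutativeRing K using (Carrier; _≈_; _+_; _*_; 0#; 1#; refl; sym; trans; +-cong; *-cong; -‿cong)
  open FieldDefs K
  open import Algebra.Properties.Group (CommutativeRing.+-group K) using (∙-cancelʳ; x∙y⁻¹≈ε⇒x≈y)
  open IntegerRingSolver K using (Polynomial; ⟦_⟧; ⟦_⟧↓; prove; _:+_; _:*_; :-_; _:-_; con; var)

  M2-setoid : Setoid kc kℓ
  M2-setoid = record
    { Carrier = M2
    ; _≈_ = _≈m_
    ; isEquivalence = record
      { refl = λ { {mat _ _ _ _} → refl , refl , refl , refl }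
      ; sym = λ { {mat _ _ _ _} {mat _ _ _ _} (a , b , c , d) → sym a , sym b , sym c , sym d }
      ; trans = λ { {mat _ _ _ _} {mat _ _ _ _} {mat _ _ _ _} (a , b , c , d) (a′ , b′ , c′ , d′) →
                      trans a a′ , trans b b′ , trans c c′ , trans d d′ }
      }
    }

  V2-setoid : Setoid kc kℓ
  V2-setoid = record
    { Carrier = V2
    ; _≈_ = _≈v_
    ; isEquivalence = record
      { refl = λ { {vec _ _} → refl , refl }
      ; sym = λ { {vec _ _} {vec _ _} (x , y) → sym x , sym y }
      ; trans = λ { {vec _ _} {vec _ _} {vec _ _} (x , y) (x′ , y′) → trans x x′ , trans y y′ }
      }
    }

  module ≈m = Setoid M2-setoid
  module ≈v = Setoid V2-setoid

  *m-cong : ∀ {m m′ n n′} → m ≈m m′ → n ≈m n′ → (m *m n) ≈m (m′ *m n′)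
  *m-cong {mat _ _ _ _} {mat _ _ _ _} {mat _ _ _ _} {mat _ _ _ _} (a , b , c , d) (a′ , b′ , c′ , d′) =
    +-cong (*-cong a a′) (*-cong b c′) , +-cong (*-cong a b′) (*-cong b d′) ,
    +-cong (*-cong c a′) (*-cong d c′) , +-cong (*-cong c b′) (*-cong d d′)

  +m-cong : ∀ {m m′ n n′} → m ≈m m′ → n ≈m n′ → (m +m n) ≈m (m′ +m n′)
  +m-cong {mat _ _ _ _} {mat _ _ _ _} {mat _ _ _ _} {mat _ _ _ _} (a , b , c , d) (a′ , b′ , c′ , d′) =
    +-cong a a′ , +-cong b b′ , +-cong c c′ , +-cong d d′

  -m-cong : ∀ {m m′ n n′} → m ≈m m′ → n ≈m n′ → (m -m n) ≈m (m′ -m n′)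
  -m-cong {mat _ _ _ _} {mat _ _ _ _} {mat _ _ _ _} {mat _ _ _ _} (a , b , c , d) (a′ , b′ , c′ , d′) =
    +-cong a (-‿cong a′) , +-cong b (-‿cong b′) , +-cong c (-‿cong c′) , +-cong d (-‿cong d′)

  ·m-cong : ∀ {s t m n} → s ≈ t → m ≈m n → (s ·m m) ≈m (t ·m n)
  ·m-cong {m = mat _ _ _ _} {mat _ _ _ _} s≈t (a , b , c , d) = *-cong s≈t a , *-cong s≈t b , *-cong s≈t c , *-cong s≈t d

  tr-cong : ∀ {m n} → m ≈m n → tr m ≈ tr n
  tr-cong {mat _ _ _ _} {mat _ _ _ _} (a , _ , _ , d) = +-cong a d

  $v-cong : ∀ {m n u v} → m ≈m n → u ≈v v → (m $v u) ≈v (n $v v)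
  $v-cong {mat _ _ _ _} {mat _ _ _ _} {vec _ _} {vec _ _} (a , b , c , d) (x , y) =
    +-cong (*-cong a x) (*-cong b y) , +-cong (*-cong c x) (*-cong d y)

  +v-cong : ∀ {u u′ v v′} → u ≈v u′ → v ≈v v′ → (u +v v) ≈v (u′ +v v′)
  +v-cong {vec _ _} {vec _ _} {vec _ _} {vec _ _} (x , y) (x′ , y′) = +-cong x x′ , +-cong y y′

  ·v-cong : ∀ {s t u v} → s ≈ t → u ≈v v → (s ·v u) ≈v (t ·v v)
  ·v-cong {u = vec _ _} {vec _ _} s≈t (x , y) = *-cong s≈t x , *-cong s≈t y

  data MatPoly (n : ℕ) : Set where
    mat : (a b c d : Polynomial n) → MatPoly n

  data VecPoly (n : ℕ) : Set where
    vec : (x y : Polynomial n) → VecPoly n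

  ⟦_⟧m : ∀ {n} → MatPoly n → Vec Carrier n → M2
  ⟦ mat a b c d ⟧m ρ = mat (⟦ a ⟧ ρ) (⟦ b ⟧ ρ) (⟦ c ⟧ ρ) (⟦ d ⟧ ρ)

  ⟦_⟧v : ∀ {n} → VecPoly n → Vec Carrier n → V2
  ⟦ vec x y ⟧v ρ = vec (⟦ x ⟧ ρ) (⟦ y ⟧ ρ)

  infixl 7 _:*m_
  infixl 6 _:+m_ _:-m_
  infixr 8 _:·m_ _:·v_ _:$v_
  infixl 6 _:+v_

  _:*m_ : ∀ {n} → MatPoly n → MatPoly n → MatPoly n
  mat a b c d :*m mat a′ b′ c′ d′ =
    mat (a :* a′ :+ b :* c′) (a :* b′ :+ b :* d′) (c :* a′ :+ d :* c′) (c :* b′ :+ d :* d′)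

  _:+m_ : ∀ {n} → MatPoly n → MatPoly n → MatPoly n
  mat a b c d :+m mat a′ b′ c′ d′ = mat (a :+ a′) (b :+ b′) (c :+ c′) (d :+ d′)

  _:-m_ : ∀ {n} → MatPoly n → MatPoly n → MatPoly n
  mat a b c d :-m mat a′ b′ c′ d′ = mat (a :- a′) (b :- b′) (c :- c′) (d :- d′)

  _:·m_ : ∀ {n} → Polynomial n → MatPoly n → MatPoly n
  s :·m mat a b c d = mat (s :* a) (s :* b) (s :* c) (s :* d)

  :0# :1# :2# : ∀ {n} → Polynomial n
  :0# = con (+ 0)
  :1# = con (+ 1)
  :2# = con (+ 2)

  :I : ∀ {n} → MatPoly n
  :I = mat :1# :0# :0# :1#

  :0 : ∀ {n} → MatPoly n
  :0 = mat :0# :0# :0# :0#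

  :0v : ∀ {n} → VecPoly n
  :0v = vec :0# :0#

  :tr : ∀ {n} → MatPoly n → Polynomial n
  :tr (mat a _ _ d) = a :+ d

  _:$v_ : ∀ {n} → MatPoly n → VecPoly n → VecPoly n
  mat a b c d :$v vec x y = vec (a :* x :+ b :* y) (c :* x :+ d :* y)

  _:·v_ : ∀ {n} → Polynomial n → VecPoly n → VecPoly n
  s :·v vec x y = vec (s :* x) (s :* y)

  _:+v_ : ∀ {n} → VecPoly n → VecPoly n → VecPoly n
  vec x y :+v vec x′ y′ = vec (x :+ x′) (y :+ y′)

  -- Slot k of an environment (saturating at the last slot); matrix variable k
  -- occupies the slots 4k, …, 4k + 3 and vector variable k the slots 2k, 2k + 1,
  -- matching environments assembled from entries and coords.
  fin : ∀ {n} → ℕ → Fin (suc n)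
  fin {zero} _ = Fin.zero
  fin {suc n} zero = Fin.zero
  fin {suc n} (suc k) = Fin.suc (fin k)

  :s : ∀ {n} → ℕ → Polynomial (suc n)
  :s k = var (fin k)

  :m : ∀ {n} → ℕ → MatPoly (suc n)
  :m k = mat (:s (4 ℕ.* k)) (:s (1 ℕ.+ 4 ℕ.* k)) (:s (2 ℕ.+ 4 ℕ.* k)) (:s (3 ℕ.+ 4 ℕ.* k))

  :v : ∀ {n} → ℕ → VecPoly (suc n)
  :v k = vec (:s (2 ℕ.* k)) (:s (1 ℕ.+ 2 ℕ.* k))

  entries : M2 → Vec Carrier 4
  entries (mat a b c d) = a ∷ b ∷ c ∷ d ∷ []

  coords : V2 → Vec Carrier 2
  coords (vec x y) = x ∷ y ∷ []

  MatNormalEq : ∀ {n} → Vec Carrier n → MatPoly n → MatPoly n → Set kℓ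
  MatNormalEq ρ (mat a b c d) (mat a′ b′ c′ d′) =
    (⟦ a ⟧↓ ρ ≈ ⟦ a′ ⟧↓ ρ) × (⟦ b ⟧↓ ρ ≈ ⟦ b′ ⟧↓ ρ) ×
    (⟦ c ⟧↓ ρ ≈ ⟦ c′ ⟧↓ ρ) × (⟦ d ⟧↓ ρ ≈ ⟦ d′ ⟧↓ ρ)

  VecNormalEq : ∀ {n} → Vec Carrier n → VecPoly n → VecPoly n → Set kℓ
  VecNormalEq ρ (vec x y) (vec x′ y′) = (⟦ x ⟧↓ ρ ≈ ⟦ x′ ⟧↓ ρ) × (⟦ y ⟧↓ ρ ≈ ⟦ y′ ⟧↓ ρ)

  prove-m : ∀ {n} (ρ : Vec Carrier n) (P Q : MatPoly n) → MatNormalEq ρ P Q → ⟦ P ⟧m ρ ≈m ⟦ Q ⟧m ρ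
  prove-m ρ (mat a b c d) (mat a′ b′ c′ d′) (a≈ , b≈ , c≈ , d≈) =
    prove ρ a a′ a≈ , prove ρ b b′ b≈ , prove ρ c c′ c≈ , prove ρ d d′ d≈

  prove-v : ∀ {n} (ρ : Vec Carrier n) (P Q : VecPoly n) → VecNormalEq ρ P Q → ⟦ P ⟧v ρ ≈v ⟦ Q ⟧v ρ
  prove-v ρ (vec x y) (vec x′ y′) (x≈ , y≈) = prove ρ x x′ x≈ , prove ρ y y′ y≈

  +v-assoc : ∀ u v w → ((u +v v) +v w) ≈v (u +v (v +v w))
  +v-assoc u v w = prove-v (coords u ++ coords v ++ coords w) ((:v 0 :+v :v 1) :+v :v 2) (:v 0 :+v (:v 1 :+v :v 2)) (refl , refl)

  +v-comm : ∀ u v → (u +v v) ≈v (v +v u)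
  +v-comm u v = prove-v (coords u ++ coords v) (:v 0 :+v :v 1) (:v 1 :+v :v 0) (refl , refl)

  +v-identityˡ : ∀ v → (0v +v v) ≈v v
  +v-identityˡ v = prove-v (coords v) (:0v :+v :v 0) (:v 0) (refl , refl)

  +v-identityʳ : ∀ v → (v +v 0v) ≈v v
  +v-identityʳ v = prove-v (coords v) (:v 0 :+v :0v) (:v 0) (refl , refl)

  V2-+-commutativeMonoid : CommutativeMonoid kc kℓ
  V2-+-commutativeMonoid = record
    { Carrier = V2
    ; _≈_ = _≈v_
    ; _∙_ = _+v_
    ; ε = 0v
    ; isCommutativeMonoid = record
      { isMonoid = record
        { isSemigroup = record
          { isMagma = record { isEquivalence = ≈v.isEquivalence ; ∙-cong = +v-cong }
          ; assoc = +v-assoc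
          }
        ; identity = +v-identityˡ , +v-identityʳ
        }
      ; comm = +v-comm
      }
    }

  +v-cancelʳ : ∀ {u v w} → (u +v w) ≈v (v +v w) → u ≈v v
  +v-cancelʳ {vec _ _} {vec _ _} {vec _ _} (x , y) = ∙-cancelʳ _ _ _ x , ∙-cancelʳ _ _ _ y

  ·v-identityˡ : ∀ v → (1# ·v v) ≈v v
  ·v-identityˡ v = prove-v (coords v) (:1# :·v :v 0) (:v 0) (refl , refl)

  ·v-zeroˡ : ∀ v → (0# ·v v) ≈v 0v
  ·v-zeroˡ v = prove-v (coords v) (:0# :·v :v 0) (:0v) (refl , refl)

  ·v-zeroʳ : ∀ s → (s ·v 0v) ≈v 0v
  ·v-zeroʳ s = prove-v (s ∷ []) (:s 0 :·v :0v) (:0v) (refl , refl)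

  ·v-assoc : ∀ s t v → (s ·v (t ·v v)) ≈v ((s * t) ·v v)
  ·v-assoc s t v = prove-v (coords v ++ s ∷ t ∷ []) (:s 2 :·v (:s 3 :·v :v 0)) ((:s 2 :* :s 3) :·v :v 0) (refl , refl)

  ·v-distribˡ : ∀ s u v → (s ·v (u +v v)) ≈v ((s ·v u) +v (s ·v v))
  ·v-distribˡ s u v = prove-v (coords u ++ coords v ++ s ∷ []) (:s 4 :·v (:v 0 :+v :v 1)) (:s 4 :·v :v 0 :+v :s 4 :·v :v 1) (refl , refl)

  ·v-distribʳ : ∀ s t v → ((s + t) ·v v) ≈v ((s ·v v) +v (t ·v v))
  ·v-distribʳ s t v = prove-v (coords v ++ s ∷ t ∷ []) ((:s 2 :+ :s 3) :·v :v 0) (:s 2 :·v :v 0 :+v :s 3 :·v :v 0) (refl , refl)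

  $v-zeroʳ : ∀ m → (m $v 0v) ≈v 0v
  $v-zeroʳ m = prove-v (entries m) (:m 0 :$v :0v) (:0v) (refl , refl)

  $v-distribˡ : ∀ m u v → (m $v (u +v v)) ≈v ((m $v u) +v (m $v v))
  $v-distribˡ m u v = prove-v (entries m ++ coords u ++ coords v) (:m 0 :$v (:v 2 :+v :v 3)) (:m 0 :$v :v 2 :+v :m 0 :$v :v 3) (refl , refl)

  $v-·v-comm : ∀ m s v → (m $v (s ·v v)) ≈v (s ·v (m $v v))
  $v-·v-comm m s v = prove-v (entries m ++ coords v ++ s ∷ []) (:m 0 :$v (:s 6 :·v :v 2)) (:s 6 :·v (:m 0 :$v :v 2)) (refl , refl)

  *m-$v : ∀ m n v → ((m *m n) $v v) ≈v (m $v (n $v v))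
  *m-$v m n v = prove-v (entries m ++ entries n ++ coords v) ((:m 0 :*m :m 1) :$v :v 4) (:m 0 :$v (:m 1 :$v :v 4)) (refl , refl)

  Im-$v : ∀ v → (Im $v v) ≈v v
  Im-$v v = prove-v (coords v) (:I :$v :v 0) (:v 0) (refl , refl)

  +m-assoc : ∀ m n o → ((m +m n) +m o) ≈m (m +m (n +m o))
  +m-assoc m n o = prove-m (entries m ++ entries n ++ entries o) ((:m 0 :+m :m 1) :+m :m 2) (:m 0 :+m (:m 1 :+m :m 2)) (refl , refl , refl , refl)

  +m-comm : ∀ m n → (m +m n) ≈m (n +m m)
  +m-comm m n = prove-m (entries m ++ entries n) (:m 0 :+m :m 1) (:m 1 :+m :m 0) (refl , refl , refl , refl)

  +m-identityˡ : ∀ m → (0m +m m) ≈m m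
  +m-identityˡ m = prove-m (entries m) (:0 :+m :m 0) (:m 0) (refl , refl , refl , refl)

  +m-identityʳ : ∀ m → (m +m 0m) ≈m m
  +m-identityʳ m = prove-m (entries m) (:m 0 :+m :0) (:m 0) (refl , refl , refl , refl)

  M2-+-commutativeMonoid : CommutativeMonoid kc kℓ
  M2-+-commutativeMonoid = record
    { Carrier = M2
    ; _≈_ = _≈m_
    ; _∙_ = _+m_
    ; ε = 0m
    ; isCommutativeMonoid = record
      { isMonoid = record
        { isSemigroup = record
          { isMagma = record { isEquivalence = ≈m.isEquivalence ; ∙-cong = +m-cong }
          ; assoc = +m-assoc
          }
        ; identity = +m-identityˡ , +m-identityʳ
        }
      ; comm = +m-comm
      }
    }

  -m≈0⇒≈ : ∀ {m n} → (m -m n) ≈m 0m → m ≈m n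
  -m≈0⇒≈ {mat _ _ _ _} {mat _ _ _ _} (a , b , c , d) =
    x∙y⁻¹≈ε⇒x≈y _ _ a , x∙y⁻¹≈ε⇒x≈y _ _ b , x∙y⁻¹≈ε⇒x≈y _ _ c , x∙y⁻¹≈ε⇒x≈y _ _ d

  mpow : M2 → ℕ → M2
  mpow m zero = Im
  mpow m (suc k) = m *m mpow m k

  ·m-identityˡ : ∀ m → (1# ·m m) ≈m m
  ·m-identityˡ m = prove-m (entries m) (:1# :·m :m 0) (:m 0) (refl , refl , refl , refl)

  ·m-zeroˡ : ∀ m → (0# ·m m) ≈m 0m
  ·m-zeroˡ m = prove-m (entries m) (:0# :·m :m 0) :0 (refl , refl , refl , refl)

  tr-+m : ∀ m n → tr (m +m n) ≈ tr m + tr n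
  tr-+m m n = prove (entries m ++ entries n) (:tr (:m 0 :+m :m 1)) (:tr (:m 0) :+ :tr (:m 1)) refl

  tr-·m : ∀ s m → tr (s ·m m) ≈ s * tr m
  tr-·m s m = prove (entries m ++ s ∷ []) (:tr (:s 4 :·m :m 0)) (:s 4 :* :tr (:m 0)) refl

module FieldFacts {kc kℓ} (K : CommutativeRing kc kℓ) (isField : FieldDefs.IsField K) where
  open import Data.Nat as ℕ using (ℕ; zero; suc; _<_; _≤_; _∸_; z<s)
  import Data.Nat.Properties as ℕ
  open import Data.Nat.Primality using (Prime)
  open import Data.Fin using (toℕ)
  open import Data.Integer using (+_)
  open import Data.Product using (_,_; proj₁; proj₂)
  open import Relation.Nullary using (¬_; contradiction)
  open import Relation.Binary.PropositionalEquality as ≡ using (_≡_)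
  open import Relation.Binary.Definitions using (tri<; tri≈; tri>)

  open CommutativeRing K
  open FieldDefs K
  open import Algebra.Properties.Ring ring using (x[y-z]≈xy-xz; [y-z]x≈yx-zx)
  open import Algebra.Properties.Group +-group using (x∙y⁻¹≈ε⇒x≈y; x≈y⇒x∙y⁻¹≈ε; ∙-cancelʳ)
  open import Algebra.Properties.Semiring.Sum semiring using (sum; sum-cong-≋; *-distribˡ-sum)
  open FiniteSums +-commutativeMonoid using (sum-shift)
  open RingArithmetic K
  open IntegerRingSolver K using (solve; _:=_; _:+_; _:-_; con)
  open PrimeArithmetic using (prime>1)
  open import Relation.Binary.Reasoning.Setoid setoid

  1≉0 : ¬ (1# ≈ 0#)
  1≉0 = proj₁ isField

  x*y≈0⇒y≈0 : ∀ {x y} → ¬ (x ≈ 0#) → x * y ≈ 0# → y ≈ 0#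
  x*y≈0⇒y≈0 {x} {y} x≉0 xy≈0 with proj₂ isField x x≉0
  ... | x⁻¹ , xx⁻¹≈1 = begin
    y              ≈⟨ *-identityˡ y ⟨
    1# * y         ≈⟨ *-congʳ (trans (*-comm x⁻¹ x) xx⁻¹≈1) ⟨
    (x⁻¹ * x) * y  ≈⟨ *-assoc x⁻¹ x y ⟩
    x⁻¹ * (x * y)  ≈⟨ *-congˡ xy≈0 ⟩
    x⁻¹ * 0#       ≈⟨ zeroʳ x⁻¹ ⟩
    0#             ∎

  *-cancelˡ : ∀ {x y z} → ¬ (x ≈ 0#) → x * y ≈ x * z → y ≈ z
  *-cancelˡ {x} {y} {z} x≉0 xy≈xz =
    x∙y⁻¹≈ε⇒x≈y y z (x*y≈0⇒y≈0 x≉0 (trans (x[y-z]≈xy-xz x y z) (x≈y⇒x∙y⁻¹≈ε xy≈xz)))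

  *-inverse-unique : ∀ {x y z} → x * y ≈ 1# → x * z ≈ 1# → y ≈ z
  *-inverse-unique xy≈1 xz≈1 = *-cancelˡ (λ x≈0 → 1≉0 (trans (sym xy≈1) (trans (*-congʳ x≈0) (zeroˡ _)))) (trans xy≈1 (sym xz≈1))

  pow≉0 : ∀ {x} n → ¬ (x ≈ 0#) → ¬ (pow x n ≈ 0#)
  pow≉0 zero x≉0 = 1≉0
  pow≉0 (suc n) x≉0 xxⁿ≈0 = pow≉0 n x≉0 (x*y≈0⇒y≈0 x≉0 xxⁿ≈0)

  pow≈1⇒≉0 : ∀ {x} n → 0 < n → pow x n ≈ 1# → ¬ (x ≈ 0#)
  pow≈1⇒≉0 {x} (suc n) _ xⁿ≈1 x≈0 = 1≉0 (begin
    1#            ≈⟨ xⁿ≈1 ⟨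
    x * pow x n   ≈⟨ *-congʳ x≈0 ⟩
    0# * pow x n  ≈⟨ zeroˡ _ ⟩
    0#            ∎)

  geometric-sum≈0 : ∀ {x} n → pow x n ≈ 1# → ¬ (x ≈ 1#) → sum {n} (λ i → pow x (toℕ i)) ≈ 0#
  geometric-sum≈0 {x} n xⁿ≈1 x≉1 = x*y≈0⇒y≈0 (λ x-1≈0 → x≉1 (x∙y⁻¹≈ε⇒x≈y x 1# x-1≈0)) (begin
    (x - 1#) * S    ≈⟨ [y-z]x≈yx-zx S x 1# ⟩
    x * S - 1# * S  ≈⟨ +-congˡ (-‿cong (*-identityˡ S)) ⟩
    x * S - S       ≈⟨ x≈y⇒x∙y⁻¹≈ε xS≈S ⟩
    0#              ∎)
    where
    S : Carrier
    S = sum {n} (λ i → pow x (toℕ i))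
    xS≈S : x * S ≈ S
    xS≈S = ∙-cancelʳ 1# (x * S) S (begin
      x * S + 1#                                ≈⟨ +-congʳ (*-distribˡ-sum {n} x (λ i → pow x (toℕ i))) ⟩
      sum {n} (λ i → pow x (suc (toℕ i))) + 1#  ≈⟨ sum-shift n (pow x) ⟩
      S + pow x n                               ≈⟨ +-congˡ xⁿ≈1 ⟩
      S + 1#                                    ∎)

  -- x²ᵐ⁺¹ = x · (x²)ᵐ, so the squares and the odd power together determine x.
  odd-power∧square⇒≈ : ∀ {x y} m → pow x (suc (m ℕ.+ m)) ≈ pow y (suc (m ℕ.+ m)) → pow x 2 ≈ pow y 2 →
                       ¬ (x ≈ 0#) → x ≈ y
  odd-power∧square⇒≈ {x} {y} m xᵖ≈yᵖ x²≈y² x≉0 = *-cancelʳ (pow≉0 m (pow≉0 2 x≉0)) (begin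
    x * pow (pow x 2) m    ≈⟨ *-congˡ (even-power x) ⟩
    pow x (suc (m ℕ.+ m))  ≈⟨ xᵖ≈yᵖ ⟩
    pow y (suc (m ℕ.+ m))  ≈⟨ *-congˡ (even-power y) ⟨
    y * pow (pow y 2) m    ≈⟨ *-congˡ (pow-congˡ m x²≈y²) ⟨
    y * pow (pow x 2) m    ∎)
    where
    *-cancelʳ : ∀ {a b c} → ¬ (c ≈ 0#) → a * c ≈ b * c → a ≈ b
    *-cancelʳ c≉0 ac≈bc = *-cancelˡ c≉0 (trans (*-comm _ _) (trans ac≈bc (*-comm _ _)))
    even-power : ∀ z → pow (pow z 2) m ≈ pow z (m ℕ.+ m)
    even-power z = trans (pow-assocʳ z 2 m) (≡.subst (λ k → pow z (m ℕ.+ k) ≈ pow z (m ℕ.+ m)) (≡.sym (ℕ.+-identityʳ m)) refl)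

  module PrimitiveRoot {p} (p-prime : Prime p) {ζ} (ζ-primitive : PrimitiveRootOfUnity p ζ) where

    ζᵖ≈1 : pow ζ p ≈ 1#
    ζᵖ≈1 = proj₁ ζ-primitive

    pow-ζ-root : ∀ j → pow (pow ζ j) p ≈ 1#
    pow-ζ-root j = begin
      pow (pow ζ j) p  ≈⟨ pow-comm ζ j p ⟩
      pow (pow ζ p) j  ≈⟨ pow-congˡ j ζᵖ≈1 ⟩
      pow 1# j         ≈⟨ pow-1# j ⟩
      1#               ∎

    pow-ζ-inverse : ∀ {j} → j ≤ p → pow ζ j * pow ζ (p ∸ j) ≈ 1#
    pow-ζ-inverse {j} j≤p = begin
      pow ζ j * pow ζ (p ∸ j)  ≈⟨ pow-homo-* ζ j (p ∸ j) ⟨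
      pow ζ (j ℕ.+ (p ∸ j))    ≡⟨ ≡.cong (pow ζ) (ℕ.m+[n∸m]≡n j≤p) ⟩
      pow ζ p                  ≈⟨ ζᵖ≈1 ⟩
      1#                       ∎

    pow-ζ≉0 : ∀ j → ¬ (pow ζ j ≈ 0#)
    pow-ζ≉0 j = pow≉0 j (pow≈1⇒≉0 p (ℕ.<-trans z<s (prime>1 p-prime)) ζᵖ≈1)

    pow-ζ-distinct : ∀ {j k} → j < k → k < p → ¬ (pow ζ j ≈ pow ζ k)
    pow-ζ-distinct {j} {k} j<k k<p ζʲ≈ζᵏ =
      proj₂ ζ-primitive (k ∸ j) (ℕ.m<n⇒0<n∸m j<k) (ℕ.≤-<-trans (ℕ.m∸n≤m k j) k<p)
        (*-cancelˡ (pow-ζ≉0 j) (begin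
          pow ζ j * pow ζ (k ∸ j)  ≈⟨ pow-homo-* ζ j (k ∸ j) ⟨
          pow ζ (j ℕ.+ (k ∸ j))    ≡⟨ ≡.cong (pow ζ) (ℕ.m+[n∸m]≡n (ℕ.<⇒≤ j<k)) ⟩
          pow ζ k                  ≈⟨ ζʲ≈ζᵏ ⟨
          pow ζ j                  ≈⟨ *-identityʳ _ ⟨
          pow ζ j * 1#             ∎))

    pow-ζ-injective : ∀ {j k} → j < p → k < p → pow ζ j ≈ pow ζ k → j ≡ k
    pow-ζ-injective {j} {k} j<p k<p ζʲ≈ζᵏ with ℕ.<-cmp j k
    ... | tri< j<k _ _ = contradiction ζʲ≈ζᵏ (pow-ζ-distinct j<k k<p)
    ... | tri≈ _ j≡k _ = j≡k
    ... | tri> _ _ k<j = contradiction (sym ζʲ≈ζᵏ) (pow-ζ-distinct k<j j<p)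

    nat-p≉0 : ¬ (nat p ≈ 0#)
    nat-p≉0 natp≈0 = pow≉0 p ζ-1≉0 [ζ-1]ᵖ≈0
      where
      ζ-1≉0 : ¬ (ζ - 1# ≈ 0#)
      ζ-1≉0 ζ-1≈0 = proj₂ ζ-primitive 1 z<s (prime>1 p-prime) (trans (*-identityʳ ζ) (x∙y⁻¹≈ε⇒x≈y ζ 1# ζ-1≈0))
      [ζ-1]ᵖ≈0 : pow (ζ - 1#) p ≈ 0#
      [ζ-1]ᵖ≈0 = ∙-cancelʳ 1# _ _ (begin
        pow (ζ - 1#) p + 1#        ≈⟨ +-congˡ (pow-1# p) ⟨
        pow (ζ - 1#) p + pow 1# p  ≈⟨ frobenius p-prime natp≈0 (ζ - 1#) 1# ⟨
        pow (ζ - 1# + 1#) p        ≈⟨ pow-congˡ p (solve 1 (λ z → z :- con (+ 1) :+ con (+ 1) := z) refl ζ) ⟩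
        pow ζ p                    ≈⟨ ζᵖ≈1 ⟩
        1#                         ≈⟨ +-identityˡ 1# ⟨
        0# + 1#                    ∎)

    character-sum≈0 : ∀ i → 0 < i → i < p → sum {p} (λ j → pow (pow ζ (toℕ j)) i) ≈ 0#
    character-sum≈0 i 0<i i<p = begin
      sum {p} (λ j → pow (pow ζ (toℕ j)) i)  ≈⟨ sum-cong-≋ {p} (λ j → pow-comm ζ (toℕ j) i) ⟩
      sum {p} (λ j → pow (pow ζ i) (toℕ j))  ≈⟨ geometric-sum≈0 p (pow-ζ-root i) (λ ζⁱ≈1 → proj₂ ζ-primitive i 0<i i<p ζⁱ≈1) ⟩
      0#                                     ∎

module Eigenvectors {kc kℓ} (K : CommutativeRing kc kℓ) (isField : FieldDefs.IsField K) where
  open import Data.Nat as ℕ using (ℕ; suc; _<_; _∸_; z<s)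
  import Data.Nat.Properties as ℕ
  open import Data.Nat.Primality using (Prime)
  open import Data.Fin as Fin using (Fin; toℕ)
  import Data.Fin.Properties as Fin
  open import Data.Product using (∃; _,_; proj₁)
  open import Relation.Nullary using (¬_; yes; no)
  open import Relation.Nullary.Decidable using (¬?; _×-dec_; _⊎-dec_; decidable-stable)
  open import Data.Sum using (inj₁; inj₂)
  open import Data.Empty using (⊥-elim)
  open import Relation.Binary.Definitions using (Decidable)
  open import Level using (_⊔_)
  open PrimeArithmetic using (prime>1)
  open import Relation.Binary.PropositionalEquality as ≡ using (_≡_)

  open CommutativeRing K
  open FieldDefs K
  open RingArithmetic K
  open Matrices K
  open FieldFacts K isField
  open import Algebra.Properties.Semiring.Sum semiring using (sum; sum-cong-≋; sum-replicate)
  open FiniteSums V2-+-commutativeMonoid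
    using () renaming ( sum to ∑v; sum-cong-≋ to ∑v-cong; sum-shift to ∑v-shift
                      ; sum-single to ∑v-single; sum-zero to ∑v-zero; ∑-comm to ∑v-comm)
  open SumHomomorphism V2-+-commutativeMonoid V2-+-commutativeMonoid using (sum-homo)
  open SumHomomorphism +-commutativeMonoid V2-+-commutativeMonoid using () renaming (sum-homo to ·v-sum-homo)
  open import Relation.Binary.Reasoning.Setoid V2-setoid

  $v-∑v : ∀ m {n} (t : Fin n → V2) → (m $v ∑v t) ≈v ∑v (λ i → m $v t i)
  $v-∑v m = sum-homo (m $v_) ($v-zeroʳ m) ($v-distribˡ m)

  ·v-∑v : ∀ s {n} (t : Fin n → V2) → (s ·v ∑v t) ≈v ∑v (λ i → s ·v t i)
  ·v-∑v s = sum-homo (s ·v_) (·v-zeroʳ s) (·v-distribˡ s)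

  sum-·v : ∀ {n} (t : Fin n → Carrier) v → (sum t ·v v) ≈v ∑v (λ i → t i ·v v)
  sum-·v t v = ·v-sum-homo (_·v v) (·v-zeroˡ v) (λ s t → ·v-distribʳ s t v) t

  module FiniteOrder {p} (M : M2) (Mᵖ≈I : mpow M p ≈m Im) where

    twisted-sum : Carrier → V2 → V2
    twisted-sum c v = ∑v {p} (λ i → pow c (toℕ i) ·v (mpow M (toℕ i) $v v))

    twisted-sum-eigenvector : ∀ {c λ′} v → pow c p ≈ 1# → c * λ′ ≈ 1# →
                              (M $v twisted-sum c v) ≈v (λ′ ·v twisted-sum c v)
    twisted-sum-eigenvector {c} {λ′} v cᵖ≈1 cλ≈1 = begin
      M $v S                 ≈⟨ ·v-identityˡ (M $v S) ⟨
      1# ·v (M $v S)         ≈⟨ ·v-cong (trans (sym cλ≈1) (*-comm c λ′)) ≈v.refl ⟩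
      (λ′ * c) ·v (M $v S)   ≈⟨ ·v-assoc λ′ c (M $v S) ⟨
      λ′ ·v (c ·v (M $v S))  ≈⟨ ·v-cong refl cMS≈S ⟩
      λ′ ·v S                ∎
      where
      T : ℕ → V2
      T i = pow c i ·v (mpow M i $v v)
      S : V2
      S = twisted-sum c v
      step : ∀ i → (c ·v (M $v T i)) ≈v T (suc i)
      step i = begin
        c ·v (M $v (pow c i ·v (mpow M i $v v)))  ≈⟨ ·v-cong refl ($v-·v-comm M (pow c i) _) ⟩
        c ·v (pow c i ·v (M $v (mpow M i $v v)))  ≈⟨ ·v-assoc c (pow c i) _ ⟩
        pow c (suc i) ·v (M $v (mpow M i $v v))   ≈⟨ ·v-cong refl (*m-$v M (mpow M i) v) ⟨
        T (suc i)                                 ∎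
      Tp≈T0 : T p ≈v T 0
      Tp≈T0 = begin
        pow c p ·v (mpow M p $v v)  ≈⟨ ·v-cong cᵖ≈1 ($v-cong Mᵖ≈I ≈v.refl) ⟩
        1# ·v (Im $v v)             ∎
      cMS≈S : (c ·v (M $v S)) ≈v S
      cMS≈S = begin
        c ·v (M $v S)                         ≈⟨ ·v-cong refl ($v-∑v M {p} _) ⟩
        c ·v ∑v {p} (λ i → M $v T (toℕ i))    ≈⟨ ·v-∑v c {p} _ ⟩
        ∑v {p} (λ i → c ·v (M $v T (toℕ i)))  ≈⟨ ∑v-cong {p} (λ i → step (toℕ i)) ⟩
        ∑v {p} (λ i → T (suc (toℕ i)))        ≈⟨ +v-cancelʳ (≈v.trans (∑v-shift p T) (+v-cong ≈v.refl Tp≈T0)) ⟩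
        S                                     ∎

  ·v-cancelˡ : ∀ {s u v} → ¬ (s ≈ 0#) → (s ·v u) ≈v (s ·v v) → u ≈v v
  ·v-cancelˡ {u = vec _ _} {vec _ _} s≉0 (x , y) = *-cancelˡ s≉0 x , *-cancelˡ s≉0 y

  IsScalar : M2 → Set (kc ⊔ kℓ)
  IsScalar m = ∃ λ s → m ≈m (s ·m Im)

  e₁ e₂ : V2
  e₁ = vec 1# 0#
  e₂ = vec 0# 1#

  basis-eigenvectors⇒scalar : ∀ {m s} → (m $v e₁) ≈v (s ·v e₁) → (m $v e₂) ≈v (s ·v e₂) → IsScalar m
  basis-eigenvectors⇒scalar {m} {s} (a , c) (b , d) =
    s , ≈m.trans (prove-m (entries m) (:m 0) (:m 0 :*m :I) (refl , refl , refl , refl)) (a , b , c , d)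

  record DistinctEigenpairs (m : M2) (p : ℕ) : Set (kc ⊔ kℓ) where
    field
      α β : Carrier
      u v : V2
      mu≈αu : (m $v u) ≈v (α ·v u)
      mv≈βv : (m $v v) ≈v (β ·v v)
      u≉0 : ¬ (u ≈v 0v)
      v≉0 : ¬ (v ≈v 0v)
      α≉β : ¬ (α ≈ β)
      αᵖ≈1 : pow α p ≈ 1#
      βᵖ≈1 : pow β p ≈ 1#

  module PrimitiveRootOrder (_≟_ : Decidable _≈_) {p} (p-prime : Prime p) {ζ} (ζ-primitive : PrimitiveRootOfUnity p ζ)
                            (M : M2) (Mᵖ≈I : mpow M p ≈m Im) where
    open FiniteOrder {p} M Mᵖ≈I
    open PrimitiveRoot p-prime ζ-primitive

    component : Fin p → V2 → V2
    component j = twisted-sum (pow ζ (toℕ j))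

    eigenvalue : Fin p → Carrier
    eigenvalue j = pow ζ (p ∸ toℕ j)

    ζʲ*eigenvalue≈1 : ∀ j → pow ζ (toℕ j) * eigenvalue j ≈ 1#
    ζʲ*eigenvalue≈1 j = pow-ζ-inverse (ℕ.<⇒≤ (Fin.toℕ<n j))

    component-eigenvector : ∀ j v → (M $v component j v) ≈v (eigenvalue j ·v component j v)
    component-eigenvector j v = twisted-sum-eigenvector v (pow-ζ-root (toℕ j)) (ζʲ*eigenvalue≈1 j)

    eigenvalue-injective : ∀ {j k} → eigenvalue j ≈ eigenvalue k → j ≡ k
    eigenvalue-injective {j} {k} λⱼ≈λₖ = Fin.toℕ-injective (pow-ζ-injective (Fin.toℕ<n j) (Fin.toℕ<n k)
      (*-inverse-unique (trans (*-comm _ _) (ζʲ*eigenvalue≈1 j))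
                        (trans (*-congʳ λⱼ≈λₖ) (trans (*-comm _ _) (ζʲ*eigenvalue≈1 k)))))

    -- Orthogonality of characters: ∑ⱼ (ζʲ)ⁱ is p for i = 0 and 0 for 0 < i < p.
    ∑-components : ∀ v → ∑v (λ j → component j v) ≈v (nat p ·v v)
    ∑-components v = begin
      ∑v {p} (λ j → ∑v {p} (λ i → coefficient j (toℕ i) ·v U i))  ≈⟨ ∑v-comm {p} {p} _ ⟩
      ∑v {p} (λ i → ∑v {p} (λ j → coefficient j (toℕ i) ·v U i))  ≈⟨ ∑v-cong {p} (λ i → sum-·v (λ j → coefficient j (toℕ i)) (U i)) ⟨
      ∑v {p} (λ i → term i)                                        ≈⟨ ∑v-single term i₀ other-terms≈0 ⟩
      term i₀
        ≡⟨ ≡.cong (λ k → sum (λ j → coefficient j k) ·v (mpow M k $v v)) (Fin.toℕ-fromℕ< 0<p) ⟩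
      sum {p} (λ _ → 1#) ·v (Im $v v)                              ≈⟨ ·v-cong (trans (sum-replicate p) (sym (nat≈×ᵤ1# p))) (Im-$v v) ⟩
      nat p ·v v                                                   ∎
      where
      U : Fin p → V2
      U i = mpow M (toℕ i) $v v
      coefficient : Fin p → ℕ → Carrier
      coefficient j i = pow (pow ζ (toℕ j)) i
      term : Fin p → V2
      term i = sum {p} (λ j → coefficient j (toℕ i)) ·v U i
      0<p : 0 < p
      0<p = ℕ.<-trans z<s (prime>1 p-prime)
      i₀ : Fin p
      i₀ = Fin.fromℕ< 0<p
      other-terms≈0 : ∀ i → ¬ (i ≡ i₀) → term i ≈v 0v
      other-terms≈0 i i≢i₀ = ≈v.trans (·v-cong (character-sum≈0 (toℕ i) 0<i (Fin.toℕ<n i)) ≈v.refl) (·v-zeroˡ (U i))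
        where
        0<i : 0 < toℕ i
        0<i = ℕ.n≢0⇒n>0 (λ i≡0 → i≢i₀ (Fin.toℕ-injective (≡.trans i≡0 (≡.sym (Fin.toℕ-fromℕ< 0<p)))))

    ≈v-dec : Decidable _≈v_
    ≈v-dec (vec x y) (vec x′ y′) = (x ≟ x′) ×-dec (y ≟ y′)

    single-component⇒eigenvector : ∀ j₀ v → (∀ j → ¬ (j ≡ j₀) → component j v ≈v 0v) →
                                   (M $v v) ≈v (eigenvalue j₀ ·v v)
    single-component⇒eigenvector j₀ v others≈0 = ·v-cancelˡ nat-p≉0 (begin
      nat p ·v (M $v v)   ≈⟨ $v-·v-comm M (nat p) v ⟨
      M $v (nat p ·v v)   ≈⟨ $v-cong ≈m.refl p·v≈c₀ ⟩
      M $v c₀             ≈⟨ component-eigenvector j₀ v ⟩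
      λ₀ ·v c₀            ≈⟨ ·v-cong refl p·v≈c₀ ⟨
      λ₀ ·v (nat p ·v v)  ≈⟨ ·v-assoc λ₀ (nat p) v ⟩
      (λ₀ * nat p) ·v v   ≈⟨ ·v-cong (*-comm λ₀ (nat p)) ≈v.refl ⟩
      (nat p * λ₀) ·v v   ≈⟨ ·v-assoc (nat p) λ₀ v ⟨
      nat p ·v (λ₀ ·v v)  ∎)
      where
      c₀ : V2
      c₀ = component j₀ v
      λ₀ : Carrier
      λ₀ = eigenvalue j₀
      p·v≈c₀ : (nat p ·v v) ≈v c₀
      p·v≈c₀ = ≈v.trans (≈v.sym (∑-components v)) (∑v-single _ j₀ others≈0)

    distinct-components⇒eigenpairs : ∀ {j₀ j₁ u w} → ¬ (j₀ ≡ j₁) →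
      ¬ (component j₀ u ≈v 0v) → ¬ (component j₁ w ≈v 0v) → DistinctEigenpairs M p
    distinct-components⇒eigenpairs {j₀} {j₁} {u} {w} j₀≢j₁ c₀≉0 c₁≉0 = record
      { α = eigenvalue j₀ ; β = eigenvalue j₁
      ; u = component j₀ u ; v = component j₁ w
      ; mu≈αu = component-eigenvector j₀ u ; mv≈βv = component-eigenvector j₁ w
      ; u≉0 = c₀≉0 ; v≉0 = c₁≉0
      ; α≉β = λ λ₀≈λ₁ → j₀≢j₁ (eigenvalue-injective λ₀≈λ₁)
      ; αᵖ≈1 = pow-ζ-root (p ∸ toℕ j₀) ; βᵖ≈1 = pow-ζ-root (p ∸ toℕ j₁)
      }

    -- Some component j₀ of e₁ is nonzero; if no other component of e₁ or e₂ were,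
    -- both would be eigenvectors for eigenvalue j₀ and M would be scalar.
    nonscalar⇒distinct-eigenpairs : ¬ IsScalar M → DistinctEigenpairs M p
    nonscalar⇒distinct-eigenpairs M-nonscalar with Fin.any? (λ j → ¬? (≈v-dec (component j e₁) 0v))
    ... | no no-component = ⊥-elim (1≉0 (proj₁ (·v-cancelˡ nat-p≉0 (begin
      nat p ·v e₁                ≈⟨ ∑-components e₁ ⟨
      ∑v (λ j → component j e₁)  ≈⟨ ∑v-zero _ (λ j → decidable-stable (≈v-dec _ 0v) (λ c≉0 → no-component (j , c≉0))) ⟩
      0v                         ≈⟨ ·v-zeroʳ (nat p) ⟨
      nat p ·v 0v                ∎))))
    ... | yes (j₀ , c₀≉0)
      with Fin.any? (λ j → ¬? (j Fin.≟ j₀) ×-dec (¬? (≈v-dec (component j e₁) 0v) ⊎-dec ¬? (≈v-dec (component j e₂) 0v)))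
    ...   | yes (j₁ , j₁≢j₀ , inj₁ c₁≉0) = distinct-components⇒eigenpairs (λ j₀≡j₁ → j₁≢j₀ (≡.sym j₀≡j₁)) c₀≉0 c₁≉0
    ...   | yes (j₁ , j₁≢j₀ , inj₂ c₁≉0) = distinct-components⇒eigenpairs (λ j₀≡j₁ → j₁≢j₀ (≡.sym j₀≡j₁)) c₀≉0 c₁≉0
    ...   | no no-other = ⊥-elim (M-nonscalar (basis-eigenvectors⇒scalar
              (single-component⇒eigenvector j₀ e₁ (λ j j≢j₀ → decidable-stable (≈v-dec _ 0v) (λ c≉0 → no-other (j , j≢j₀ , inj₁ c≉0))))
              (single-component⇒eigenvector j₀ e₂ (λ j j≢j₀ → decidable-stable (≈v-dec _ 0v) (λ c≉0 → no-other (j , j≢j₀ , inj₂ c≉0))))))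

module CharacteristicPolynomial {kc kℓ} (K : CommutativeRing kc kℓ) (isField : FieldDefs.IsField K)
                                (_≟_ : Decidable (CommutativeRing._≈_ K)) where
  open import Data.Nat as ℕ using (ℕ; suc)
  open import Data.Vec using (Vec; []; _∷_; _++_)
  open import Data.Product using (∃; _,_; proj₁; proj₂)
  open import Relation.Nullary using (¬_; yes; no)
  open import Data.Empty using (⊥-elim)
  open import Relation.Binary.PropositionalEquality as ≡ using (_≡_)

  open CommutativeRing K
  open FieldDefs K
  open RingArithmetic K
  open IntegerRingSolver K
  open Matrices K
  open FieldFacts K isField
  open Eigenvectors K isField using (DistinctEigenpairs)
  open import Algebra.Properties.Group +-group using (x∙y⁻¹≈ε⇒x≈y)

  ·v≈0⇒≈0 : ∀ {s u} → (s ·v u) ≈v 0v → ¬ (u ≈v 0v) → s ≈ 0#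
  ·v≈0⇒≈0 {s} {vec x y} (sx≈0 , sy≈0) u≉0 with x ≟ 0# | y ≟ 0#
  ... | no x≉0 | _ = x*y≈0⇒y≈0 x≉0 (trans (*-comm x s) sx≈0)
  ... | yes _ | no y≉0 = x*y≈0⇒y≈0 y≉0 (trans (*-comm y s) sy≈0)
  ... | yes x≈0 | yes y≈0 = ⊥-elim (u≉0 (x≈0 , y≈0))

  :charPoly : ∀ {n} → MatPoly n → Polynomial n → Polynomial n
  :charPoly (mat a b c d) t = t :* t :- (a :+ d) :* t :+ (a :* d :- b :* c)

  :adj : ∀ {n} → MatPoly n → MatPoly n
  :adj (mat a b c d) = mat d (:- b) (:- c) a

  -- Cayley–Hamilton: adj(m − λI)·(m − λI) = χₘ(λ)·I, applied to u.
  charPoly-annihilates-eigenvector : ∀ {m λ′ u} → (m $v u) ≈v (λ′ ·v u) → (charPoly m λ′ ·v u) ≈v 0v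
  charPoly-annihilates-eigenvector {m} {λ′} {u} mu≈λu = ≈v.trans
    (prove-v (entries m ++ coords u ++ λ′ ∷ [])
      (:charPoly (:m 0) (:s 6) :·v :v 2)
      (:adj (:m 0 :-m :s 6 :·m :I) :$v (:m 0 :$v :v 2 :+v (:- :s 6) :·v :v 2)) (refl , refl))
    (≈v.trans ($v-cong ≈m.refl mu-λu≈0) ($v-zeroʳ _))
    where
    mu-λu≈0 : ((m $v u) +v ((- λ′) ·v u)) ≈v 0v
    mu-λu≈0 = ≈v.trans (+v-cong mu≈λu ≈v.refl)
      (prove-v (coords u ++ λ′ ∷ []) (:s 2 :·v :v 0 :+v (:- :s 2) :·v :v 0) (:0v) (refl , refl))

  eigenvalue⇒root : ∀ {m λ′ u} → (m $v u) ≈v (λ′ ·v u) → ¬ (u ≈v 0v) → IsRoot m λ′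
  eigenvalue⇒root mu≈λu u≉0 = ·v≈0⇒≈0 (charPoly-annihilates-eigenvector mu≈λu) u≉0

  charPoly-factor : ∀ m α t → charPoly m t ≈ (t - α) * (t - (tr m - α)) + charPoly m α
  charPoly-factor m α t = prove (entries m ++ α ∷ t ∷ [])
    (:charPoly (:m 0) (:s 5)) ((:s 5 :- :s 4) :* (:s 5 :- (:tr (:m 0) :- :s 4)) :+ :charPoly (:m 0) (:s 4)) refl

  other-root : ∀ {m α t} → IsRoot m α → IsRoot m t → ¬ (t ≈ α) → t ≈ tr m - α
  other-root {m} {α} {t} α-root t-root t≉α = x∙y⁻¹≈ε⇒x≈y _ _ (x*y≈0⇒y≈0 (λ t-α≈0 → t≉α (x∙y⁻¹≈ε⇒x≈y t α t-α≈0)) (begin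
    (t - α) * (t - (tr m - α))                 ≈⟨ +-identityʳ _ ⟨
    (t - α) * (t - (tr m - α)) + 0#            ≈⟨ +-congˡ α-root ⟨
    (t - α) * (t - (tr m - α)) + charPoly m α  ≈⟨ charPoly-factor m α t ⟨
    charPoly m t                               ≈⟨ t-root ⟩
    0#                                         ∎))
    where open import Relation.Binary.Reasoning.Setoid setoid

  module DistinctEigenvalues {m p} (E : DistinctEigenpairs m p) where
    open DistinctEigenpairs E

    α-root : IsRoot m α
    α-root = eigenvalue⇒root mu≈αu u≉0

    β≈tr-α : β ≈ tr m - α
    β≈tr-α = other-root α-root (eigenvalue⇒root mv≈βv v≉0) (λ β≈α → α≉β (sym β≈α))

    α-simple : IsSimpleRoot m α
    α-simple = α-root , λ α-[tr-α]≈0 → α≉β (trans (x∙y⁻¹≈ε⇒x≈y _ _ α-[tr-α]≈0) (sym β≈tr-α))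

    root≉α⇒≈β : ∀ {t} → IsRoot m t → ¬ (t ≈ α) → t ≈ β
    root≉α⇒≈β t-root t≉α = trans (other-root α-root t-root t≉α) (sym β≈tr-α)

    -- π = (m − β′ I)/(α − β′) with β′ = tr m − α, the projection onto the
    -- α-eigenspace along the β-eigenspace.
    private
      s : Carrier
      s = proj₁ (proj₂ isField (α - (tr m - α)) (proj₂ α-simple))

      s[α-β′]≈1 : s * (α - (tr m - α)) ≈ 1#
      s[α-β′]≈1 = trans (*-comm _ _) (proj₂ (proj₂ isField (α - (tr m - α)) (proj₂ α-simple)))

    π : M2
    π = s ·m (m -m ((tr m - α) ·m Im))

    :π : ∀ {n} → MatPoly (suc n)
    :π = :s 5 :·m (:m 0 :-m (:tr (:m 0) :- :s 4) :·m :I)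

    π-comm : (π *m m) ≈m (m *m π)
    π-comm = prove-m (entries m ++ α ∷ s ∷ []) (:π :*m :m 0) (:m 0 :*m :π) (refl , refl , refl , refl)

    tr-π : tr π ≈ 1#
    tr-π = trans (prove (entries m ++ α ∷ s ∷ []) (:tr :π) (:s 5 :* (:s 4 :- (:tr (:m 0) :- :s 4))) refl) s[α-β′]≈1

    π-fixes : ∀ v → (m $v v) ≈v (α ·v v) → (π $v v) ≈v v
    π-fixes v mv≈αv = begin
      π $v v                                    ≈⟨ prove-v ρ (:π :$v :v 3) (:s 5 :·v (:m 0 :$v :v 3 :+v (:- :β′) :·v :v 3)) (refl , refl) ⟩
      s ·v ((m $v v) +v ((- (tr m - α)) ·v v))  ≈⟨ ·v-cong refl (+v-cong mv≈αv ≈v.refl) ⟩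
      s ·v ((α ·v v) +v ((- (tr m - α)) ·v v))
        ≈⟨ prove-v ρ (:s 5 :·v (:s 4 :·v :v 3 :+v (:- :β′) :·v :v 3)) ((:s 5 :* (:s 4 :- :β′)) :·v :v 3) (refl , refl) ⟩
      (s * (α - (tr m - α))) ·v v               ≈⟨ ·v-cong s[α-β′]≈1 ≈v.refl ⟩
      1# ·v v                                   ≈⟨ ·v-identityˡ v ⟩
      v                                         ∎
      where
      open import Relation.Binary.Reasoning.Setoid V2-setoid
      ρ : Vec Carrier 8
      ρ = entries m ++ α ∷ s ∷ coords v
      :β′ : Polynomial 8
      :β′ = :tr (:m 0) :- :s 4

    π-image : ∀ v → (m $v (π $v v)) ≈v (α ·v (π $v v))
    π-image v = begin
      m $v (π $v v)
        ≈⟨ prove-v ρ (:m 0 :$v (:π :$v :v 3)) (:s 4 :·v (:π :$v :v 3) :+v (:- (:s 5 :* :charPoly (:m 0) (:s 4))) :·v :v 3) (refl , refl) ⟩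
      (α ·v (π $v v)) +v ((- (s * charPoly m α)) ·v v)  ≈⟨ +v-cong ≈v.refl (·v-cong (-‿cong (*-congˡ α-root)) ≈v.refl) ⟩
      (α ·v (π $v v)) +v ((- (s * 0#)) ·v v)
        ≈⟨ prove-v ρ (:s 4 :·v (:π :$v :v 3) :+v (:- (:s 5 :* :0#)) :·v :v 3) (:s 4 :·v (:π :$v :v 3)) (refl , refl) ⟩
      α ·v (π $v v)                                     ∎
      where
      open import Relation.Binary.Reasoning.Setoid V2-setoid
      ρ : Vec Carrier 8
      ρ = entries m ++ α ∷ s ∷ coords v

    squares-distinct : (∃ λ k → p ≡ suc (k ℕ.+ k)) → ∀ t → IsRoot m t → ¬ (t ≈ α) → ¬ (pow α 2 ≈ pow t 2)
    squares-distinct (k , ≡.refl) t t-root t≉α α²≈t² =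
      t≉α (sym (odd-power∧square⇒≈ k (trans αᵖ≈1 (sym tᵖ≈1)) α²≈t² (pow≈1⇒≉0 p ℕ.z<s αᵖ≈1)))
      where
      tᵖ≈1 : pow t p ≈ 1#
      tᵖ≈1 = trans (pow-congˡ p (root≉α⇒≈β t-root t≉α)) βᵖ≈1

module FiniteGroup {c ℓ} (G : Group c ℓ) {n : ℕ} (order : GroupOrder G n) where
  open import Data.Fin using (Fin)
  open import Data.Fin.Permutation using (Permutation; permutation)
  open import Data.Product using (proj₁; proj₂)
  open import Relation.Binary.PropositionalEquality as ≡ using (_≡_)
  open import Algebra.Bundles using (CommutativeMonoid)

  open Group G

  enum : Fin n → Carrier
  enum = proj₁ order

  index : Carrier → Fin n
  index x = proj₁ (proj₂ (proj₂ order) x)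

  enum-index : ∀ x → enum (index x) ≈ x
  enum-index x = proj₂ (proj₂ (proj₂ order) x)

  enum-injective : ∀ {i j} → enum i ≈ enum j → i ≡ j
  enum-injective = proj₁ (proj₂ order) _ _

  index≡⇒≈ : ∀ {x i} → index x ≡ i → x ≈ enum i
  index≡⇒≈ ≡.refl = sym (enum-index _)

  ≈⇒index≡ : ∀ {x i} → x ≈ enum i → index x ≡ i
  ≈⇒index≡ x≈enum-i = enum-injective (trans (enum-index _) x≈enum-i)

  index-cong : ∀ {x y} → x ≈ y → index x ≡ index y
  index-cong {x} {y} x≈y = ≈⇒index≡ (trans x≈y (sym (enum-index y)))

  translation : Carrier → Permutation n n
  translation g = permutation (λ i → index (g ∙ enum i)) (λ i → index (g ⁻¹ ∙ enum i))
                              (λ i → cancel g (g ⁻¹) (inverseʳ g) i) (λ i → cancel (g ⁻¹) g (inverseˡ g) i)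
    where
    open import Relation.Binary.Reasoning.Setoid setoid
    cancel : ∀ a b → a ∙ b ≈ ε → ∀ i → index (a ∙ enum (index (b ∙ enum i))) ≡ i
    cancel a b ab≈ε i = ≈⇒index≡ (begin
      a ∙ enum (index (b ∙ enum i))  ≈⟨ ∙-congˡ (enum-index _) ⟩
      a ∙ (b ∙ enum i)               ≈⟨ assoc a b (enum i) ⟨
      (a ∙ b) ∙ enum i               ≈⟨ ∙-congʳ ab≈ε ⟩
      ε ∙ enum i                     ≈⟨ identityˡ (enum i) ⟩
      enum i                         ∎)

  sum-translate : ∀ {c′ ℓ′} (M : CommutativeMonoid c′ ℓ′) (F : Carrier → CommutativeMonoid.Carrier M) →
    (∀ {x y} → x ≈ y → CommutativeMonoid._≈_ M (F x) (F y)) →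
    ∀ g → CommutativeMonoid._≈_ M (FiniteSums.sum M (λ i → F (enum i))) (FiniteSums.sum M (λ i → F (g ∙ enum i)))
  sum-translate M F F-cong g = M.trans (sum-permute (λ i → F (enum i)) (translation g))
                                       (sum-cong-≋ (λ i → F-cong (enum-index (g ∙ enum i))))
    where
    module M = CommutativeMonoid M
    open FiniteSums M using (sum-permute; sum-cong-≋)

module QuotientOrder {c ℓ} (G : Group c ℓ) {n : ℕ} (order : GroupOrder G n) where
  open import Data.Nat as ℕ using (_*_)
  import Data.Nat.Properties as ℕ
  open import Data.Nat.Divisibility using (_∣_; divides; ∣-trans; ∣-refl; ∣1⇒≡1; m∣m*n)
  open import Data.Nat.GCD using (gcd; gcd-greatest)
  open import Data.Nat.Primality using (Prime)
  open import Data.Fin as Fin using (Fin)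
  import Data.Fin.Properties as Fin
  open import Data.Product using (∃; _,_; proj₁; proj₂)
  open import Relation.Nullary using (Dec; yes; no; contradiction)
  open import Data.Unit using (tt)
  open import Relation.Binary.PropositionalEquality as ≡ using (_≡_)
  open import Algebra.Morphism.Structures using (module GroupMorphisms)
  open PrimeArithmetic using (prime>1)
  open FiniteSums ℕ.+-0-commutativeMonoid using (sum; sum-cong-≗; ∑-comm; sum-single)

  open Group G
  open FiniteGroup G order using (enum; sum-translate)

  indicator : ∀ {a} {A : Set a} → Dec A → ℕ
  indicator (yes _) = 1
  indicator (no _) = 0

  indicator-cong : ∀ {a b} {A : Set a} {B : Set b} (A? : Dec A) (B? : Dec B) → (A → B) → (B → A) →
                   indicator A? ≡ indicator B?
  indicator-cong (yes _) (yes _) _ _ = ≡.refl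
  indicator-cong (yes a) (no ¬b) A→B _ = contradiction (A→B a) ¬b
  indicator-cong (no ¬a) (yes b) _ B→A = contradiction (B→A b) ¬a
  indicator-cong (no _) (no _) _ _ = ≡.refl

  sum-const : ∀ m k → sum {m} (λ _ → k) ≡ m * k
  sum-const ℕ.zero k = ≡.refl
  sum-const (ℕ.suc m) k = ≡.cong (k ℕ.+_) (sum-const m k)

  module Fibres {N} (Q : Group c ℓ) {φ : Carrier → Group.Carrier Q}
                (φ-homomorphism : GroupMorphisms.IsGroupHomomorphism (Group.rawGroup G) (Group.rawGroup Q) φ)
                (φ-surjective : ∀ q → ∃ λ g → Group._≈_ Q (φ g) q) (Q-order : GroupOrder Q N) where
    private
      module Q = Group Q
      module Qᶠ = FiniteGroup Q Q-order
    open GroupMorphisms.IsGroupHomomorphism φ-homomorphism using (homo; ⟦⟧-cong)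
    open import Algebra.Properties.Group Q using (identityʳ-unique)

    hits : Carrier → Fin N → ℕ
    hits g j = indicator (Qᶠ.index (φ g) Fin.≟ j)

    fibre : Fin N → ℕ
    fibre j = sum {n} (λ i → hits (enum i) j)

    kernel : Fin N
    kernel = Qᶠ.index Q.ε

    hits-once : ∀ g → sum {N} (hits g) ≡ 1
    hits-once g = ≡.trans
      (sum-single (hits g) (Qᶠ.index (φ g)) (λ j j≢ → indicator-cong (_ Fin.≟ j) (no (λ ())) (λ i≡j → j≢ (≡.sym i≡j)) (λ ())))
      (indicator-cong (Qᶠ.index (φ g) Fin.≟ Qᶠ.index (φ g)) (yes tt) (λ _ → tt) (λ _ → ≡.refl))

    -- Left translation by some s with φ s = q_j carries the kernel onto the fibre over q_j.
    fibre≡kernel : ∀ j → fibre j ≡ fibre kernel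
    fibre≡kernel j = ≡.trans
      (sum-translate ℕ.+-0-commutativeMonoid (λ g → hits g j) (λ x≈y → ≡.cong (λ k → indicator (k Fin.≟ j)) (Qᶠ.index-cong (⟦⟧-cong x≈y))) s)
      (sum-cong-≗ {n} (λ i → indicator-cong (Qᶠ.index (φ (s ∙ enum i)) Fin.≟ j) (Qᶠ.index (φ (enum i)) Fin.≟ kernel) to from))
      where
      s : Carrier
      s = proj₁ (φ-surjective (Qᶠ.enum j))
      translate : ∀ g → φ (s ∙ g) Q.≈ Qᶠ.enum j Q.∙ φ g
      translate g = Q.trans (homo s g) (Q.∙-congʳ (proj₂ (φ-surjective (Qᶠ.enum j))))
      enum-kernel≈ε : Qᶠ.enum kernel Q.≈ Q.ε
      enum-kernel≈ε = Qᶠ.enum-index Q.ε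
      to : ∀ {g} → Qᶠ.index (φ (s ∙ g)) ≡ j → Qᶠ.index (φ g) ≡ kernel
      to {g} φsg↦j = Qᶠ.≈⇒index≡ (Q.trans
        (identityʳ-unique (Qᶠ.enum j) (φ g) (Q.trans (Q.sym (translate g)) (Qᶠ.index≡⇒≈ φsg↦j))) (Q.sym enum-kernel≈ε))
      from : ∀ {g} → Qᶠ.index (φ g) ≡ kernel → Qᶠ.index (φ (s ∙ g)) ≡ j
      from {g} φg↦kernel = Qᶠ.≈⇒index≡ (Q.trans (translate g)
        (Q.trans (Q.∙-congˡ (Q.trans (Qᶠ.index≡⇒≈ φg↦kernel) enum-kernel≈ε)) (Q.identityʳ _)))

  -- Count the pairs (g, q) with φ g = q both ways: each g lies in exactly one
  -- fibre, and all N fibres have the size of the kernel.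
  quotient-order-divides : ∀ {N} → HasQuotientOfOrder G N → N ∣ n
  quotient-order-divides {N} (Q , φ , φ-homomorphism , φ-surjective , Q-order) = divides (fibre kernel) (begin
    n                                               ≡⟨ ℕ.*-identityʳ n ⟨
    n * 1                                           ≡⟨ sum-const n 1 ⟨
    sum {n} (λ i → 1)                               ≡⟨ sum-cong-≗ (λ i → hits-once (enum i)) ⟨
    sum {n} (λ i → sum {N} (λ j → hits (enum i) j)) ≡⟨ ∑-comm (λ i j → hits (enum i) j) ⟩
    sum {N} fibre                                   ≡⟨ sum-cong-≗ fibre≡kernel ⟩
    sum {N} (λ _ → fibre kernel)                    ≡⟨ sum-const N (fibre kernel) ⟩
    N * fibre kernel                                ≡⟨ ℕ.*-comm N (fibre kernel) ⟩
    fibre kernel * N                                ∎)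
    where
    open ≡.≡-Reasoning
    open Fibres Q φ-homomorphism φ-surjective Q-order

  coprime-order⇒no-power-quotient : ∀ {l} → Prime l → gcd l n ≡ 1 → NoLPowerQuotient G l
  coprime-order⇒no-power-quotient {l} l-prime gcd≡1 a quotient =
    ℕ.<-irrefl (≡.sym (∣1⇒≡1 l∣1)) (prime>1 l-prime)
    where
    l∣n : l ∣ n
    l∣n = ∣-trans (m∣m*n (l ℕ.^ a)) (quotient-order-divides quotient)
    l∣1 : l ∣ 1
    l∣1 = ≡.subst (l ∣_) gcd≡1 (gcd-greatest (∣-refl {l}) l∣n)

module Representation {kc kℓ c ℓ} (K : CommutativeRing kc kℓ) (isField : FieldDefs.IsField K)
                      (G : Group c ℓ) (r : FieldDefs.Rep2 K G) where
  open import Data.Nat using (zero; suc)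
  open import Data.Vec using ([]; _∷_; _++_)
  open import Data.Product using (∃; _×_; _,_; proj₁; proj₂)
  open import Data.Sum using (_⊎_; inj₁; inj₂)
  open import Data.Unit using (tt)
  open import Data.Empty using (⊥-elim)
  open import Level using (Lift; lift; lower; _⊔_)
  open import Relation.Nullary using (¬_; yes; no)
  open import Relation.Binary.Definitions using (Decidable)

  open CommutativeRing K
  open FieldDefs K
  open Rep2 r
  private module G = Group G
  open IntegerRingSolver K
  open Matrices K
  open FieldFacts K isField using (1≉0)
  open Eigenvectors K isField using (IsScalar)

  ρ-inverseʳ : ∀ g → (ρ g *m ρ (g G.⁻¹)) ≈m Im
  ρ-inverseʳ g = ≈m.trans (≈m.sym (ρ-mul g (g G.⁻¹))) (≈m.trans (ρ-cong (G.inverseʳ g)) ρ-one)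

  ρ-inverseˡ : ∀ g → (ρ (g G.⁻¹) *m ρ g) ≈m Im
  ρ-inverseˡ g = ≈m.trans (≈m.sym (ρ-mul (g G.⁻¹) g)) (≈m.trans (ρ-cong (G.inverseˡ g)) ρ-one)

  ρ-gpow : ∀ g k → ρ (gpow G g k) ≈m mpow (ρ g) k
  ρ-gpow g zero = ρ-one
  ρ-gpow g (suc k) = ≈m.trans (ρ-mul g (gpow G g k)) (*m-cong ≈m.refl (ρ-gpow g k))

  gpow≈ε⇒mpow≈I : ∀ g k → gpow G g k G.≈ G.ε → mpow (ρ g) k ≈m Im
  gpow≈ε⇒mpow≈I g k gᵏ≈ε = ≈m.trans (≈m.sym (ρ-gpow g k)) (≈m.trans (ρ-cong gᵏ≈ε) ρ-one)

  ad-cong : ∀ g {m n} → m ≈m n → ad G r g m ≈m ad G r g n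
  ad-cong g m≈n = *m-cong ≈m.refl (*m-cong m≈n ≈m.refl)

  ad-+m : ∀ g m n → ad G r g (m +m n) ≈m (ad G r g m +m ad G r g n)
  ad-+m g m n = prove-m (entries (ρ g) ++ entries m ++ entries n ++ entries (ρ (g G.⁻¹)))
    (:m 0 :*m ((:m 1 :+m :m 2) :*m :m 3)) (:m 0 :*m (:m 1 :*m :m 3) :+m :m 0 :*m (:m 2 :*m :m 3)) (refl , refl , refl , refl)

  ad--m : ∀ g m n → ad G r g (m -m n) ≈m (ad G r g m -m ad G r g n)
  ad--m g m n = prove-m (entries (ρ g) ++ entries m ++ entries n ++ entries (ρ (g G.⁻¹)))
    (:m 0 :*m ((:m 1 :-m :m 2) :*m :m 3)) (:m 0 :*m (:m 1 :*m :m 3) :-m :m 0 :*m (:m 2 :*m :m 3)) (refl , refl , refl , refl)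

  ad-·m : ∀ g s m → ad G r g (s ·m m) ≈m (s ·m ad G r g m)
  ad-·m g s m = prove-m (entries (ρ g) ++ entries m ++ entries (ρ (g G.⁻¹)) ++ s ∷ [])
    (:m 0 :*m ((:s 12 :·m :m 1) :*m :m 2)) (:s 12 :·m (:m 0 :*m (:m 1 :*m :m 2))) (refl , refl , refl , refl)

  ad-0m : ∀ g → ad G r g 0m ≈m 0m
  ad-0m g = prove-m (entries (ρ g) ++ entries (ρ (g G.⁻¹))) (:m 0 :*m (:0 :*m :m 1)) :0 (refl , refl , refl , refl)

  ad-Im : ∀ g → ad G r g Im ≈m Im
  ad-Im g = ≈m.trans (prove-m (entries (ρ g) ++ entries (ρ (g G.⁻¹))) (:m 0 :*m (:I :*m :m 1)) (:m 0 :*m :m 1) (refl , refl , refl , refl))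
                     (ρ-inverseʳ g)

  ad-tr : ∀ g m → tr (ad G r g m) ≈ tr m
  ad-tr g m = begin
    tr (ad G r g m)                    ≈⟨ prove (entries (ρ g) ++ entries m ++ entries (ρ (g G.⁻¹)))
                                            (:tr (:m 0 :*m (:m 1 :*m :m 2))) (:tr (:m 1 :*m (:m 2 :*m :m 0))) refl ⟩
    tr (m *m (ρ (g G.⁻¹) *m ρ g))      ≈⟨ tr-cong (*m-cong ≈m.refl (ρ-inverseˡ g)) ⟩
    tr (m *m Im)                       ≈⟨ prove (entries m) (:tr (:m 0 :*m :I)) (:tr (:m 0)) refl ⟩
    tr m                               ∎
    where open import Relation.Binary.Reasoning.Setoid setoid

  zero-or : Set (kc ⊔ kℓ) → V2 → Set (kc ⊔ kℓ)
  zero-or Q v = Lift kc (v ≈v 0v) ⊎ Q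

  zero-or-subspace : ∀ Q → IsSubspace K2 (zero-or Q)
  zero-or-subspace Q =
      (λ { u≈v (inj₁ (lift u≈0)) → inj₁ (lift (≈v.trans (≈v.sym u≈v) u≈0)) ; _ (inj₂ q) → inj₂ q })
    , inj₁ (lift ≈v.refl)
    , (λ { (inj₁ (lift u≈0)) (inj₁ (lift v≈0)) → inj₁ (lift (≈v.trans (+v-cong u≈0 v≈0) (+v-identityʳ 0v)))
         ; (inj₂ q) _ → inj₂ q
         ; _ (inj₂ q) → inj₂ q })
    , (λ { s (inj₁ (lift v≈0)) → inj₁ (lift (≈v.trans (·v-cong refl v≈0) (·v-zeroʳ s))) ; s (inj₂ q) → inj₂ q })

  zero-or-invariant : ∀ Q → IsInvariant K2 (std G r) (zero-or Q)
  zero-or-invariant Q g (inj₁ (lift v≈0)) = inj₁ (lift (≈v.trans ($v-cong ≈m.refl v≈0) ($v-zeroʳ (ρ g))))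
  zero-or-invariant Q g (inj₂ q) = inj₂ q

  irreducible⇒excluded-middle : IrreducibleRep G r → (Q : Set (kc ⊔ kℓ)) → Q ⊎ ¬ Q
  irreducible⇒excluded-middle (_ , _ , _ , maximal) Q
    with maximal (zero-or Q) (zero-or-subspace Q) (zero-or-invariant Q) (λ _ → lift tt)
  ... | inj₁ zero-or-Q⊆0 = inj₂ (λ q → 1≉0 (proj₁ (zero-or-Q⊆0 {vec 1# 0#} (inj₂ q))))
  ... | inj₂ K²⊆zero-or-Q with K²⊆zero-or-Q {vec 1# 0#} (lift tt)
  ...   | inj₁ (lift e₁≈0) = ⊥-elim (1≉0 (proj₁ e₁≈0))
  ...   | inj₂ q = inj₁ q

  irreducible⇒≈-decidable : IrreducibleRep G r → Decidable _≈_
  irreducible⇒≈-decidable irreducible x y with irreducible⇒excluded-middle irreducible (Lift kc (x ≈ y))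
  ... | inj₁ (lift x≈y) = yes x≈y
  ... | inj₂ x≉y = no (λ x≈y → x≉y (lift x≈y))

  Span : M2 → M2 → Set (kc ⊔ kℓ)
  Span x m = ∃ λ s → m ≈m (s ·m x)

  span-subspace : ∀ x → IsSubspace gl2 (Span x)
  span-subspace x =
      (λ m≈n (s , m≈sx) → s , ≈m.trans (≈m.sym m≈n) m≈sx)
    , (0# , ≈m.sym (·m-zeroˡ x))
    , (λ { (s , m≈sx) (t , n≈tx) → s + t , ≈m.trans (+m-cong m≈sx n≈tx)
           (prove-m (entries x ++ s ∷ t ∷ []) (:s 4 :·m :m 0 :+m :s 5 :·m :m 0) ((:s 4 :+ :s 5) :·m :m 0) (refl , refl , refl , refl)) })
    , (λ { t (s , m≈sx) → t * s , ≈m.trans (·m-cong refl m≈sx)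
           (prove-m (entries x ++ s ∷ t ∷ []) (:s 5 :·m (:s 4 :·m :m 0)) ((:s 5 :* :s 4) :·m :m 0) (refl , refl , refl , refl)) })

  span-invariant : ∀ x → (∀ g → ad G r g x ≈m x) → IsInvariant gl2 (ad G r) (Span x)
  span-invariant x x-invariant g (s , m≈sx) = s , ≈m.trans (ad-cong g m≈sx) (≈m.trans (ad-·m g s x) (·m-cong refl (x-invariant g)))

  span⊆sl2 : ∀ x → sl2 x → ∀ {m} → Span x m → sl2 m
  span⊆sl2 x (lift trx≈0) {m} (s , m≈sx) = lift (begin
    tr m         ≈⟨ tr-cong m≈sx ⟩
    tr (s ·m x)  ≈⟨ tr-·m s x ⟩
    s * tr x     ≈⟨ *-congˡ trx≈0 ⟩
    s * 0#       ≈⟨ zeroʳ s ⟩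
    0#           ∎)
    where open import Relation.Binary.Reasoning.Setoid setoid

  -- An invariant x ∈ sl₂ spans an invariant line in sl₂; as sl₂ is not a line,
  -- irreducibility forces x = 0.
  ad⁰-irreducible⇒invariants≈0 : Ad0Irreducible G r → ∀ x → sl2 x → (∀ g → ad G r g x ≈m x) → x ≈m 0m
  ad⁰-irreducible⇒invariants≈0 (_ , _ , _ , maximal) x x∈sl2 x-invariant
    with maximal (Span x) (span-subspace x) (span-invariant x x-invariant) (span⊆sl2 x x∈sl2)
  ... | inj₁ span⊆0 = span⊆0 (1# , ≈m.sym (·m-identityˡ x))
  ... | inj₂ sl2⊆span
    with sl2⊆span {mat 0# 1# 0# 0#} (lift (+-identityʳ 0#)) | sl2⊆span {mat 0# 0# 1# 0#} (lift (+-identityʳ 0#))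
  ...   | s , _ , 1≈sb , 0≈sc , _ | t , _ , 0≈tb , 1≈tc , _ = ⊥-elim (1≉0 (begin
    1#                           ≈⟨ *-identityˡ 1# ⟨
    1# * 1#                      ≈⟨ *-cong 1≈tc 1≈sb ⟩
    (t * M2.c x) * (s * M2.b x)  ≈⟨ prove (t ∷ M2.c x ∷ s ∷ M2.b x ∷ []) ((:s 0 :* :s 1) :* (:s 2 :* :s 3)) ((:s 0 :* :s 3) :* (:s 2 :* :s 1)) refl ⟩
    (t * M2.b x) * (s * M2.c x)  ≈⟨ *-cong 0≈tb 0≈sc ⟨
    0# * 0#                      ≈⟨ zeroˡ 0# ⟩
    0#                           ∎))
    where open import Relation.Binary.Reasoning.Setoid setoid

  ad⁰-irreducible⇒2≉0 : Ad0Irreducible G r → ¬ (1# + 1# ≈ 0#)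
  ad⁰-irreducible⇒2≉0 ad⁰-irreducible 2≈0 = 1≉0 (proj₁ (ad⁰-irreducible⇒invariants≈0 ad⁰-irreducible Im (lift 2≈0) ad-Im))

  noncentral⇒nonscalar : Faithful G r → ∀ {g} → ¬ Central G g → ¬ IsScalar (ρ g)
  noncentral⇒nonscalar faithful {g} g-noncentral (s , ρg≈sI) = g-noncentral λ h → faithful _ _ (begin
    ρ (g G.∙ h)       ≈⟨ ρ-mul g h ⟩
    ρ g *m ρ h        ≈⟨ *m-cong ρg≈sI ≈m.refl ⟩
    (s ·m Im) *m ρ h  ≈⟨ prove-m (entries (ρ h) ++ s ∷ []) ((:s 4 :·m :I) :*m :m 0) (:m 0 :*m (:s 4 :·m :I)) (refl , refl , refl , refl) ⟩
    ρ h *m (s ·m Im)  ≈⟨ *m-cong ≈m.refl ρg≈sI ⟨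
    ρ h *m ρ g        ≈⟨ ρ-mul h g ⟨
    ρ (h G.∙ g)       ∎)
    where open import Relation.Binary.Reasoning.Setoid M2-setoid

  module Averaging {n} (order : GroupOrder G n) (n-invertible : ∃ λ y → nat n * y ≈ 1#) where
    open FiniteGroup G order using (enum; sum-translate)
    open FiniteSums M2-+-commutativeMonoid using (sum; sum-cong-≋; ∑-distrib-+)
    open SumHomomorphism M2-+-commutativeMonoid M2-+-commutativeMonoid using (sum-homo)
    open SumHomomorphism M2-+-commutativeMonoid +-commutativeMonoid using () renaming (sum-homo to tr-sum-homo)
    open FiniteSums +-commutativeMonoid using () renaming (sum-zero to ∑-zero)

    n⁻¹ : Carrier
    n⁻¹ = proj₁ n-invertible

    n*n⁻¹≈1 : nat n * n⁻¹ ≈ 1#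
    n*n⁻¹≈1 = proj₂ n-invertible

    sum-const : ∀ k m → sum {k} (λ _ → m) ≈m (nat k ·m m)
    sum-const zero m = ≈m.sym (·m-zeroˡ m)
    sum-const (suc k) m = ≈m.trans (+m-cong ≈m.refl (sum-const k m))
      (prove-m (entries m ++ nat k ∷ []) (:m 0 :+m :s 4 :·m :m 0) ((:1# :+ :s 4) :·m :m 0) (refl , refl , refl , refl))

    cocycle⇒coboundary : ∀ (f : G.Carrier → M2) → (∀ {g h} → g G.≈ h → f g ≈m f h) → (∀ g → sl2 (f g)) →
      (∀ g h → f (g G.∙ h) ≈m (f g +m ad G r g (f h))) → ∃ λ x → sl2 x × (∀ g → f g ≈m (ad G r g x -m x))
    cocycle⇒coboundary f f-cong f∈sl2 f-cocycle = x , x∈sl2 , coboundary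
      where
      S : M2
      S = sum {n} (λ i → f (enum i))
      x : M2
      x = (- n⁻¹) ·m S
      x∈sl2 : sl2 x
      x∈sl2 = lift (begin
        tr ((- n⁻¹) ·m S)  ≈⟨ prove (entries S ++ n⁻¹ ∷ []) (:tr ((:- :s 4) :·m :m 0)) ((:- :s 4) :* :tr (:m 0)) refl ⟩
        (- n⁻¹) * tr S     ≈⟨ *-congˡ (tr-sum-homo tr (+-identityʳ 0#) tr-+m {n} _) ⟩
        (- n⁻¹) * Σtr      ≈⟨ *-congˡ (∑-zero _ (λ i → lower (f∈sl2 (enum i)))) ⟩
        (- n⁻¹) * 0#       ≈⟨ zeroʳ _ ⟩
        0#                 ∎)
        where
        open import Relation.Binary.Reasoning.Setoid setoid
        open import Algebra.Properties.Semiring.Sum semiring using () renaming (sum to ∑)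
        Σtr : Carrier
        Σtr = ∑ {n} (λ i → tr (f (enum i)))
      ad-f : ∀ g h → ad G r g (f h) ≈m (f (g G.∙ h) +m ((- 1#) ·m f g))
      ad-f g h = ≈m.trans
        (prove-m (entries (f g) ++ entries (ad G r g (f h))) (:m 1) ((:m 0 :+m :m 1) :+m ((:- :1#) :·m :m 0)) (refl , refl , refl , refl))
                          (+m-cong (≈m.sym (f-cocycle g h)) ≈m.refl)
      ad-S : ∀ g → ad G r g S ≈m (S +m (nat n ·m ((- 1#) ·m f g)))
      ad-S g = begin
        ad G r g S
          ≈⟨ sum-homo (ad G r g) (ad-0m g) (ad-+m g) {n} _ ⟩
        sum {n} (λ i → ad G r g (f (enum i)))
          ≈⟨ sum-cong-≋ {n} (λ i → ad-f g (enum i)) ⟩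
        sum {n} (λ i → f (g G.∙ enum i) +m ((- 1#) ·m f g))
          ≈⟨ ∑-distrib-+ {n} _ _ ⟩
        sum {n} (λ i → f (g G.∙ enum i)) +m sum {n} (λ _ → (- 1#) ·m f g)
          ≈⟨ +m-cong (≈m.sym (sum-translate M2-+-commutativeMonoid f f-cong g)) (sum-const n _) ⟩
        S +m (nat n ·m ((- 1#) ·m f g))
          ∎
        where open import Relation.Binary.Reasoning.Setoid M2-setoid
      coboundary : ∀ g → f g ≈m (ad G r g x -m x)
      coboundary g = ≈m.sym (begin
        ad G r g x -m x
          ≈⟨ -m-cong (ad-·m g (- n⁻¹) S) ≈m.refl ⟩
        ((- n⁻¹) ·m ad G r g S) -m x
          ≈⟨ -m-cong (·m-cong refl (ad-S g)) ≈m.refl ⟩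
        ((- n⁻¹) ·m (S +m (nat n ·m ((- 1#) ·m f g)))) -m ((- n⁻¹) ·m S)
          ≈⟨ prove-m (entries S ++ entries (f g) ++ n⁻¹ ∷ nat n ∷ [])
               (((:- :s 8) :·m (:m 0 :+m :s 9 :·m ((:- :1#) :·m :m 1))) :-m ((:- :s 8) :·m :m 0))
               ((:s 9 :* :s 8) :·m :m 1) (refl , refl , refl , refl) ⟩
        (nat n * n⁻¹) ·m f g
          ≈⟨ ·m-cong n*n⁻¹≈1 ≈m.refl ⟩
        1# ·m f g
          ≈⟨ ·m-identityˡ (f g) ⟩
        f g
          ∎)
        where open import Relation.Binary.Reasoning.Setoid M2-setoid

module SubmoduleDetection {kc kℓ c ℓ} (K : CommutativeRing kc kℓ) (isField : FieldDefs.IsField K)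
                 (_≟_ : Decidable (CommutativeRing._≈_ K)) (G : Group c ℓ) (r : FieldDefs.Rep2 K G)
                 (ad⁰-irreducible : FieldDefs.Ad0Irreducible K G r) where
  open import Data.Vec using ([]; _∷_; _++_)
  open import Data.Product using (_×_; _,_; proj₁; proj₂)
  open import Data.Sum using (inj₁; inj₂)
  open import Data.Empty using (⊥-elim)
  open import Level using (lift; _⊔_)
  open import Relation.Nullary using (¬_)

  open CommutativeRing K
  open FieldDefs K
  open Rep2 r
  private module G = Group G
  open IntegerRingSolver K
  open Matrices K
  open FieldFacts K isField using (x*y≈0⇒y≈0)
  open Eigenvectors K isField using (DistinctEigenpairs)
  open CharacteristicPolynomial K isField _≟_
  open Representation K isField G r

  2≉0 : ¬ (1# + 1# ≈ 0#)
  2≉0 = ad⁰-irreducible⇒2≉0 ad⁰-irreducible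

  sl2-part : (M2 → Set (kc ⊔ kℓ)) → M2 → Set (kc ⊔ kℓ)
  sl2-part W m = W m × sl2 m

  sl2-part-subspace : ∀ {W} → IsSubspace gl2 W → IsSubspace gl2 (sl2-part W)
  sl2-part-subspace (W-cong , W-0 , W-+ , W-·) =
      (λ m≈n (m∈W , lift trm≈0) → W-cong m≈n m∈W , lift (trans (sym (tr-cong m≈n)) trm≈0))
    , (W-0 , lift (+-identityʳ 0#))
    , (λ { {m} {n} (m∈W , lift trm≈0) (n∈W , lift trn≈0) → W-+ m∈W n∈W , lift (trans
          (tr-+m m n) (trans (+-cong trm≈0 trn≈0) (+-identityʳ 0#))) })
    , (λ { s {m} (m∈W , lift trm≈0) → W-· s m∈W , lift (trans
          (tr-·m s m) (trans (*-congˡ trm≈0) (zeroʳ s))) })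

  sl2-part-invariant : ∀ {W} → IsInvariant gl2 (ad G r) W → IsInvariant gl2 (ad G r) (sl2-part W)
  sl2-part-invariant W-invariant g {m} (m∈W , lift trm≈0) = W-invariant g m∈W , lift (trans (ad-tr g m) trm≈0)

  -- If W meets sl₂ trivially, each ad g w − w ∈ W ∩ sl₂ vanishes; then
  -- 2w − tr(w)·I is an invariant of sl₂, hence zero.
  trivial-sl2-part⇒scalar : ∀ {W} → IsSubspace gl2 W → IsInvariant gl2 (ad G r) W →
    (∀ {m} → sl2-part W m → m ≈m 0m) → ∀ {w} → W w → ((1# + 1#) ·m w) ≈m (tr w ·m Im)
  trivial-sl2-part⇒scalar (_ , _ , W-+ , W-·) W-invariant sl2-part⊆0 {w} w∈W =
    -m≈0⇒≈ (ad⁰-irreducible⇒invariants≈0 ad⁰-irreducible y y∈sl2 y-invariant)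
    where
    w-invariant : ∀ g → ad G r g w ≈m w
    w-invariant g = -m≈0⇒≈ (≈m.trans
      (prove-m (entries (ad G r g w) ++ entries w) (:m 0 :-m :m 1) (:m 0 :+m (:- :1#) :·m :m 1) (refl , refl , refl , refl))
      (sl2-part⊆0 (W-+ (W-invariant g w∈W) (W-· (- 1#) w∈W) , lift (trans
        (prove (entries (ad G r g w) ++ entries w) (:tr (:m 0 :+m (:- :1#) :·m :m 1)) (:tr (:m 0) :- :tr (:m 1)) refl)
        (x≈y⇒x∙y⁻¹≈ε (ad-tr g w))))))
      where open import Algebra.Properties.Group +-group using (x≈y⇒x∙y⁻¹≈ε)
    y : M2
    y = ((1# + 1#) ·m w) -m (tr w ·m Im)
    y∈sl2 : sl2 y
    y∈sl2 = lift (prove (entries w) (:tr ((:2# :·m :m 0) :-m (:tr (:m 0) :·m :I))) :0# refl)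
    y-invariant : ∀ g → ad G r g y ≈m y
    y-invariant g = ≈m.trans (ad--m g _ _) (-m-cong (≈m.trans (ad-·m g _ w) (·m-cong refl (w-invariant g)))
                                                   (≈m.trans (ad-·m g _ Im) (·m-cong refl (ad-Im g))))

  ·m-cancel : ∀ {s m} → ¬ (s ≈ 0#) → (s ·m m) ≈m 0m → m ≈m 0m
  ·m-cancel {m = mat _ _ _ _} s≉0 (a , b , c , d) =
    x*y≈0⇒y≈0 s≉0 a , x*y≈0⇒y≈0 s≉0 b , x*y≈0⇒y≈0 s≉0 c , x*y≈0⇒y≈0 s≉0 d

  module _ {g p} (E : DistinctEigenpairs (ρ g) p) where
    open DistinctEigenpairs E
    open DistinctEigenvalues E

    π-eigenprojection : IsEigenProj G r (ρ g) α π
    π-eigenprojection = π-comm , π-fixes , π-image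

    π-detects-scalar : ∀ {w t} → ((1# + 1#) ·m w) ≈m (t ·m Im) → ¬ (w ≈m 0m) → ¬ ((π $v (w $v u)) ≈v 0v)
    π-detects-scalar {w} {t} 2w≈tI w≉0 πwu≈0 =
      w≉0 (·m-cancel 2≉0 (≈m.trans 2w≈tI (≈m.trans (·m-cong t≈0 ≈m.refl) (·m-zeroˡ Im))))
      where
      t·u≈0 : (t ·v u) ≈v 0v
      t·u≈0 = begin
        t ·v u                        ≈⟨ ·v-cong refl (π-fixes u mu≈αu) ⟨
        t ·v (π $v u)
          ≈⟨ prove-v (entries π ++ coords u ++ t ∷ []) (:s 6 :·v (:m 0 :$v :v 2)) (:m 0 :$v ((:s 6 :·m :I) :$v :v 2)) (refl , refl) ⟩
        π $v ((t ·m Im) $v u)         ≈⟨ $v-cong ≈m.refl ($v-cong 2w≈tI ≈v.refl) ⟨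
        π $v (((1# + 1#) ·m w) $v u)
          ≈⟨ prove-v (entries π ++ entries w ++ coords u) (:m 0 :$v ((:2# :·m :m 1) :$v :v 4)) (:2# :·v (:m 0 :$v (:m 1 :$v :v 4))) (refl , refl) ⟩
        (1# + 1#) ·v (π $v (w $v u))  ≈⟨ ·v-cong refl πwu≈0 ⟩
        (1# + 1#) ·v 0v               ≈⟨ ·v-zeroʳ (1# + 1#) ⟩
        0v                            ∎
        where open import Relation.Binary.Reasoning.Setoid V2-setoid
      t≈0 : t ≈ 0#
      t≈0 = ·v≈0⇒≈0 t·u≈0 u≉0

    2π-I : M2
    2π-I = ((1# + 1#) ·m π) -m Im

    2π-I∈sl2 : sl2 2π-I
    2π-I∈sl2 = lift (begin
      tr 2π-I                  ≈⟨ prove (entries π) (:tr ((:2# :·m :m 0) :-m :I)) (:2# :* (:tr (:m 0) :- :1#)) refl ⟩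
      (1# + 1#) * (tr π - 1#)  ≈⟨ *-congˡ (x≈y⇒x∙y⁻¹≈ε tr-π) ⟩
      (1# + 1#) * 0#           ≈⟨ zeroʳ _ ⟩
      0#                       ∎)
      where
      open import Relation.Binary.Reasoning.Setoid setoid
      open import Algebra.Properties.Group +-group using (x≈y⇒x∙y⁻¹≈ε)

    π[2π-I]u≈u : (π $v (2π-I $v u)) ≈v u
    π[2π-I]u≈u = begin
      π $v (2π-I $v u)                                 ≈⟨ prove-v (entries π ++ coords u)
                                                            (:m 0 :$v (((:2# :·m :m 0) :-m :I) :$v :v 2))
                                                            (:2# :·v (:m 0 :$v (:m 0 :$v :v 2)) :+v (:- :1#) :·v (:m 0 :$v :v 2)) (refl , refl) ⟩
      ((1# + 1#) ·v (π $v (π $v u))) +v ((- 1#) ·v (π $v u))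
                                                       ≈⟨ +v-cong (·v-cong refl (≈v.trans ($v-cong ≈m.refl πu≈u) πu≈u)) (·v-cong refl πu≈u) ⟩
      ((1# + 1#) ·v u) +v ((- 1#) ·v u)                 ≈⟨ prove-v (coords u) (:2# :·v :v 0 :+v (:- :1#) :·v :v 0) (:v 0) (refl , refl) ⟩
      u                                                ∎
      where
      open import Relation.Binary.Reasoning.Setoid V2-setoid
      πu≈u : (π $v u) ≈v u
      πu≈u = π-fixes u mu≈αu

    -- W ∩ sl₂ is either 0, making W scalar, or all of W, making W = sl₂ ∋ 2π − I.
    irreducible-submodule-detected : ∀ W → IsIrreducibleSub gl2 (ad G r) W → ProjNonzero G r (ρ g) α W
    irreducible-submodule-detected W (W-subspace , W-invariant , (w₀ , w₀∈W , w₀≉0) , W-maximal)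
      with W-maximal (sl2-part W) (sl2-part-subspace W-subspace) (sl2-part-invariant W-invariant) proj₁
    ... | inj₁ sl2-part⊆0 =
      π , π-eigenprojection , w₀ , w₀∈W , u , mu≈αu ,
      π-detects-scalar (trivial-sl2-part⇒scalar W-subspace W-invariant sl2-part⊆0 w₀∈W) w₀≉0
    ... | inj₂ W⊆sl2-part with proj₂ (proj₂ (proj₂ ad⁰-irreducible)) W W-subspace W-invariant (λ w∈W → proj₂ (W⊆sl2-part w∈W))
    ...   | inj₁ W⊆0 = ⊥-elim (w₀≉0 (W⊆0 w₀∈W))
    ...   | inj₂ sl2⊆W = π , π-eigenprojection , 2π-I , sl2⊆W 2π-I∈sl2 , u , mu≈αu ,
                         λ π[2π-I]u≈0 → u≉0 (≈v.trans (≈v.sym π[2π-I]u≈u) π[2π-I]u≈0)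

lemma4p3p3 : ∀ {kc kℓ c ℓ} (l : ℕ) → Prime l
    → (K : CommutativeRing kc kℓ) → FieldDefs.IsField K → FieldDefs.AlgebraicExtOfFl K l
    → (G : Group c ℓ) → (n : ℕ) → GroupOrder G n → gcd l n ≡ 1
    → (r : FieldDefs.Rep2 K G) → FieldDefs.Faithful K G r
    → FieldDefs.IrreducibleRep K G r
    → FieldDefs.Ad0Irreducible K G r
    → (∃ λ (p : ℕ) → Prime p × ¬ (p ≡ 2)
        × (∃ λ g → HasElemOrder G g p × ¬ Central G g)
        × (∃ λ ζ → FieldDefs.PrimitiveRootOfUnity K p ζ))
    → FieldDefs.IsBig K G r l 2
lemma4p3p3 l l-prime K isField (char-l , _) G n order gcd≡1 r faithful irreducible ad⁰-irreducible
           (p , p-prime , p≢2 , (g , (gᵖ≈ε , _) , g-noncentral) , (ζ , ζ-primitive)) =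
    coprime-order⇒no-power-quotient l-prime gcd≡1
  , ad⁰-irreducible⇒invariants≈0 ad⁰-irreducible
  , Averaging.cocycle⇒coboundary order (coprime⇒nat-invertible l n char-l gcd≡1)
  , λ W W-irreducible → g , α , α-simple , squares-distinct (odd-prime p-prime p≢2) ,
                         irreducible-submodule-detected E W W-irreducible
  where
  open PrimeArithmetic using (odd-prime)
  open RingArithmetic K using (coprime⇒nat-invertible)
  open QuotientOrder G order using (coprime-order⇒no-power-quotient)
  open Representation K isField G r
  open FieldDefs K using (module Rep2)
  open Eigenvectors K isField using (DistinctEigenpairs; module PrimitiveRootOrder)

  _≟_ : Decidable (CommutativeRing._≈_ K)
  _≟_ = irreducible⇒≈-decidable irreducible

  open CharacteristicPolynomial K isField _≟_ using (module DistinctEigenvalues)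
  open SubmoduleDetection K isField _≟_ G r ad⁰-irreducible using (irreducible-submodule-detected)

  E : DistinctEigenpairs (Rep2.ρ r g) p
  E = PrimitiveRootOrder.nonscalar⇒distinct-eigenpairs _≟_ p-prime ζ-primitive _ (gpow≈ε⇒mpow≈I g p gᵖ≈ε)
        (noncentral⇒nonscalar faithful g-noncentral)

  open DistinctEigenpairs E using (α)
  open DistinctEigenvalues E using (α-simple; squares-distinct)
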